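{- Let $\sigma,\tau\in S_n$ and let $\mathcal{C} = \{\gamma_1, \ldots, \gamma_r\}$ be a set of cycles of odd length in the disjoint cycle decomposition of $\big(\sigma^{\mathsf{CT}}\big)^{ -1}\tau^{\mathsf{CT}}$. Let $\omega$ and $\pi$ be the cycles in the disjoint cycle decomposition of $\sigma^{ -1}\tau$ which contain $n-1$ and $\sigma(n-1)$, respectively. Then, under a suitable rearrangement of the indices of the elements of $\mathcal{C}$, the disjoint cycle decomposition of $\sigma^{ -1}\tau$ has a set $\mathcal{D}$ of cycle factors of odd length, where $\mathcal{D}$ satisfies the following: (1) If ${\rm hd}\big(\sigma^{\mathsf{CT}},\tau^{\mathsf{CT}}\big) = {\rm hd}(\sigma,\tau)$, then $\mathcal{D}$ is $\mathcal{C}$ or $\{\gamma_1, \ldots, \gamma_{r-1}, \omega\pi\}$, with $|\omega\pi| = |\gamma_r|$; (2) If ${\rm hd}\big(\sigma^{\mathsf{CT}},\tau^{\mathsf{CT}}\big) = {\rm hd}(\sigma,\tau) - 1$ and $r > 1$, then $\mathcal{D}$ is $\{\gamma_1, \ldots, \gamma_{r-2}, \delta_{r-1}\}$ for some $\delta_{r-1} \in \{\gamma_{r-1}, \omega\}$, with $|\delta_{r-1}| \in \{|\gamma_{r-1}|, \ |\gamma_{r-1}| + |\gamma_r| + 1\}$; (3) If ${\rm hd}\big(\sigma^{\mathsf{CT}},\tau^{\mathsf{CT}}\big) = {\rm hd}(\sigma,\tau) - 2$, then $\mathcal{D}$ is $\mathcal{C}$ or $\{\gamma_1, \ldots, \gamma_{r-1},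 \omega\}$, with $|\omega| = |\gamma_r| + 2$; (4) If ${\rm hd}\big(\sigma^{\mathsf{CT}},\tau^{\mathsf{CT}}\big) = {\rm hd}(\sigma,\tau) - 3$, then $\mathcal{D} = \mathcal{C} \cup \{\omega\}$, with $|\omega| = 3$.
   Context: $S_n$ is the symmetric group on $\{0,1,\ldots,n-1\}$; $S_{n-1}$ acts on $\{0,\ldots,n-2\}$. Permutations are composed from left to right: $\tau\sigma(x):=\sigma(\tau(x))$, so $\sigma^{ -1}\tau(x)=\tau(\sigma^{ -1}(x))$. The Hamming distance is ${\rm hd}(\sigma,\tau)=|\{x: \sigma(x)\neq\tau(x)\}|$. The contraction of $\sigma\in S_n$ is the permutation $\sigma^{\mathsf{CT}}\in S_{n-1}$ defined by $\sigma^{\mathsf{CT}}(x)=\sigma(n-1)$ if $x=\sigma^{ -1}(n-1)$ and $\sigma^{\mathsf{CT}}(x)=\sigma(x)$ otherwise (i.e. delete $n-1$ from the cycle notation of $\sigma$). $|\rho|$ denotes the length of a cycle $\rho$ (number of symbols moved); the identity $(0)$ has length zero, and a symbol fixed by a permutation is said to belong to a cycle of zero length in its disjoint cycle decomposition. -}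

module Defs where

open import Data.Nat using (ℕ; zero; suc; _+_; _*_)
import Data.Fin as F
open import Data.Fin using (Fin; toℕ; fromℕ; inject₁; lower₁; _≟_)
open import Data.Fin.Properties
  using (toℕ-injective; toℕ-fromℕ; fromℕ≢inject₁; inject₁-injective; inject₁-lower₁)
open import Data.Fin.Permutation using (Permutation′; permutation; _⟨$⟩ʳ_; _⟨$⟩ˡ_; inverseˡ; inverseʳ)
open import Data.List using (List; length; filter; allFin)
open import Data.Product using (∃-syntax; _×_; _,_)
open import Data.Empty using (⊥-elim-irr)
open import Function using (_∘_; id)
open import Relation.Nullary using (¬_; yes; no; ¬?)
open import Relation.Nullary.Negation using (contradiction)
open import Relation.Binary.PropositionalEquality using (_≡_; _≢_; refl; sym; trans; cong)

hd : ∀ {n} → (Fin n → Fin n) → (Fin n → Fin n) → ℕ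
hd {n} f g = length (filter (λ x → ¬? (f x ≟ g x)) (allFin n))

-- Length |ρ| of a permutation/cycle: the number of symbols it moves
-- (so the identity has length zero).
len : ∀ {n} → (Fin n → Fin n) → ℕ
len {n} ρ = length (filter (λ x → ¬? (ρ x ≟ x)) (allFin n))

Odd : ℕ → Set
Odd m = ∃[ j ] m ≡ suc (2 * j)

iter : ∀ {n} → (Fin n → Fin n) → ℕ → Fin n → Fin n
iter f zero    x = x
iter f (suc m) x = f (iter f m x)

InOrbit : ∀ {n} → Permutation′ n → Fin n → Fin n → Set
InOrbit α x y = ∃[ m ] iter (α ⟨$⟩ʳ_) m x ≡ y

-- ρ is the cycle of the disjoint cycle decomposition of α which contains x
-- (it acts as α on the cycle of x and fixes everything else; if α fixes x,
-- this is the identity, i.e. the cycle of zero length).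
IsCycleOf : ∀ {n} → Permutation′ n → Fin n → (Fin n → Fin n) → Set
IsCycleOf α x ρ =
  ∀ y → (InOrbit α x y → ρ y ≡ α ⟨$⟩ʳ y) × (¬ InOrbit α x y → ρ y ≡ y)

OddCycleFactor : ∀ {n} → Permutation′ n → (Fin n → Fin n) → Set
OddCycleFactor α ρ = (∃[ x ] IsCycleOf α x ρ) × Odd (len ρ)

private
  low : ∀ {k} (y : Fin (suc k)) → .(y ≢ fromℕ k) → Fin k
  low {zero}  F.zero    ne = ⊥-elim-irr (ne refl)
  low {suc k} F.zero    _  = F.zero
  low {suc k} (F.suc y) ne = F.suc (low y (λ e → ne (cong F.suc e)))

  low-inj : ∀ {k} (y : Fin (suc k)) .(ne : y ≢ fromℕ k) → inject₁ (low y ne) ≡ y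
  low-inj {zero}  F.zero    ne = ⊥-elim-irr (ne refl)
  low-inj {suc k} F.zero    _  = refl
  low-inj {suc k} (F.suc y) ne = cong F.suc (low-inj y (λ e → ne (cong F.suc e)))

  low-eq : ∀ {k} (y : Fin (suc k)) .(ne : y ≢ fromℕ k) (x : Fin k) → y ≡ inject₁ x → low y ne ≡ x
  low-eq y ne x e = inject₁-injective (trans (low-inj y ne) e)

  module _ {k : ℕ} (f g : Fin (suc k) → Fin (suc k))
           (gf : ∀ a → g (f a) ≡ a) where

    f-inj : ∀ {a b} → f a ≡ f b → a ≡ b
    f-inj {a} {b} e = trans (sym (gf a)) (trans (cong g e) (gf b))

    cf : Fin k → Fin k
    cf x with f (inject₁ x) ≟ fromℕ k
    ... | yes e = low (f (fromℕ k)) (λ e' → fromℕ≢inject₁ (f-inj (trans e' (sym e))))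
    ... | no ne = low (f (inject₁ x)) ne

  cf-inv : ∀ {k} (f g : Fin (suc k) → Fin (suc k))
           (gf : ∀ a → g (f a) ≡ a) (fg : ∀ a → f (g a) ≡ a) →
           ∀ x → cf g f fg (cf f g gf x) ≡ x
  cf-inv {k} f g gf fg x with f (inject₁ x) ≟ fromℕ k
  ... | yes e with g (inject₁ (low (f (fromℕ k)) (λ e' → fromℕ≢inject₁ (f-inj f g gf (trans e' (sym e))))))
                   ≟ fromℕ k
  ...   | yes e2 = low-eq _ _ x (trans (cong g (sym e)) (gf (inject₁ x)))
  ...   | no ne2 = contradiction (trans (cong g (low-inj _ _)) (gf (fromℕ k))) ne2
  cf-inv {k} f g gf fg x | no ne with g (inject₁ (low (f (inject₁ x)) ne)) ≟ fromℕ k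
  ...   | yes e2 = contradiction (trans (sym (trans (cong g (low-inj _ _)) (gf (inject₁ x)))) e2)
                                 (λ e3 → fromℕ≢inject₁ (sym e3))
  ...   | no ne2 = low-eq _ _ x (trans (cong g (low-inj _ _)) (gf (inject₁ x)))

-- The contraction σ^CT ∈ S_k of σ ∈ S_{k+1}: delete n-1 = fromℕ k from the
-- cycle notation of σ.
contraction : ∀ {k} → Permutation′ (suc k) → Permutation′ k
contraction σ =
  permutation (cf f g gf) (cf g f fg) (cf-inv g f fg gf) (cf-inv f g gf fg)
  where
    f = σ ⟨$⟩ʳ_
    g = σ ⟨$⟩ˡ_
    gf : ∀ a → g (f a) ≡ a
    gf a = inverseˡ σ
    fg : ∀ a → f (g a) ≡ a
    fg a = inverseʳ σ

-- Embedding S_k ↪ S_{k+1} (elements of S_{n-1} viewed as permutations of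
-- {0,…,n-1} fixing n-1), used to compare cycles of (σ^CT)^{-1}τ^CT with
-- cycles of σ^{-1}τ.
ext : ∀ {k} → (Fin k → Fin k) → Fin (suc k) → Fin (suc k)
ext {k} ρ y with y ≟ fromℕ k
... | yes _ = fromℕ k
... | no ne = inject₁ (ρ (low y ne))

module Submission where

-- Write α = σ⁻¹τ and m = n-1. Contracting σ and τ deletes m from the cycle of α
-- through it: the contracted quotient A (extended to fix m) agrees with α except
-- that A(m) = m, A(u) = α(m) and A(c) = α(u), where u = σ(m) and c = σ(τ⁻¹(m)) is
-- the α-preimage of m. As hd(σ, τ) = |σ⁻¹τ|, the drop of the Hamming distance is
-- the number of the points m, u, c moved by α minus the number moved by A, and
-- every cycle of A avoiding u and c is a cycle of α. If u is on the α-cycle ω of m,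
-- then A splits ω into {m} and the A-cycles of u and c, so ω absorbs the (at most
-- two) given odd cycles through u and c; otherwise the A-cycle of u is ω with m
-- replaced by u. Putting the affected cycles last and comparing the possible drops
-- 0, 1, 2, 3 with these configurations gives the four cases.

open import Defs
open import Data.Nat using (ℕ; zero; suc; _+_; _*_; _<_; _≤_; _∸_; z≤n; s≤s)
import Data.Nat.Properties as ℕ
open import Data.Nat.DivMod using (_%_; _/_; m≡m%n+[m/n]*n; m%n<n)
open import Data.Nat.Tactic.RingSolver using (solve-∀)
open import Data.Fin using (Fin; zero; suc; toℕ; fromℕ; fromℕ<; inject₁; lower₁; punchIn; _≟_)
import Data.Fin.Properties as Fin
open import Data.Fin.Permutation
  using (Permutation′; permutation; _⟨$⟩ʳ_; _⟨$⟩ˡ_; flip; _∘ₚ_; inverseˡ; inverseʳ; transpose)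
import Data.Fin.Permutation as Perm
import Data.Nat.ListAction as ListAction
open import Data.List as List using (List; []; _∷_; length; filter; tabulate)
open import Data.List.Relation.Unary.Any using (here; there)
open import Data.List.Membership.Propositional using (_∈_; _∉_)
open import Data.List.Relation.Unary.All using ([]; _∷_)
import Data.List.Relation.Unary.All as All
open import Data.List.Relation.Unary.AllPairs using ([]; _∷_)
open import Data.List.Relation.Unary.Unique.Propositional using (Unique)
open import Data.Product using (∃-syntax; _×_; _,_; proj₁; proj₂; map₂)
open import Data.Sum using (_⊎_; inj₁; inj₂; [_,_])
open import Function using (_∘_; id)
open import Relation.Unary using (Pred; Decidable)
open import Relation.Nullary using (¬_; Dec; yes; no; ¬?)
open import Relation.Nullary.Decidable using (dec-true; dec-false)
open import Relation.Nullary.Negation using (contradiction)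
open import Relation.Binary.PropositionalEquality
  using (_≡_; _≢_; refl; sym; trans; cong; cong₂; subst; module ≡-Reasoning)
open import Algebra.Properties.CommutativeMonoid.Sum ℕ.+-0-commutativeMonoid
  using (sum; sum-cong-≗; ∑-distrib-+; sum-remove; sum-init-last; sum-permute; sum-replicate-zero)

open ≡-Reasoning

𝟙 : ∀ {p} {P : Set p} → Dec P → ℕ
𝟙 (yes _) = 1
𝟙 (no _)  = 0

module _ {p} {P : Set p} where

  𝟙-yes : (d : Dec P) → P → 𝟙 d ≡ 1
  𝟙-yes (yes _) _  = refl
  𝟙-yes (no ¬p) p  = contradiction p ¬p

  𝟙-no : (d : Dec P) → ¬ P → 𝟙 d ≡ 0
  𝟙-no (yes p) ¬p = contradiction p ¬p
  𝟙-no (no _)  _  = refl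

  𝟙-cong : ∀ {q} {Q : Set q} (d : Dec P) (e : Dec Q) → (P → Q) → (Q → P) → 𝟙 d ≡ 𝟙 e
  𝟙-cong (yes _) (yes _)  _ _ = refl
  𝟙-cong (yes p) (no ¬q)  f _ = contradiction (f p) ¬q
  𝟙-cong (no ¬p) (yes q)  _ g = contradiction (g q) ¬p
  𝟙-cong (no _)  (no _)   _ _ = refl

length-filter-tabulate : ∀ {n a p} {A : Set a} {P : Pred A p} (P? : Decidable P) (f : Fin n → A) →
                         length (filter P? (tabulate f)) ≡ sum (λ i → 𝟙 (P? (f i)))
length-filter-tabulate {zero}  P? f = refl
length-filter-tabulate {suc n} P? f with P? (f zero)
... | yes _ = cong suc (length-filter-tabulate P? (f ∘ suc))
... | no _  = length-filter-tabulate P? (f ∘ suc)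

sum-support : ∀ {n} (t : Fin n → ℕ) (a : Fin n) → (∀ y → y ≢ a → t y ≡ 0) → sum t ≡ t a
sum-support {suc n} t a t≡0 = begin
  sum t                       ≡⟨ sum-remove {i = a} t ⟩
  t a + sum (t ∘ punchIn a)   ≡⟨ cong (t a +_) (sum-cong-≗ {x = t ∘ punchIn a} {y = λ (_ : Fin _) → 0}
                                                           (λ j → t≡0 _ (Fin.punchInᵢ≢i a j))) ⟩
  t a + sum {n} (λ _ → 0)     ≡⟨ cong (t a +_) (sum-replicate-zero n) ⟩
  t a + 0                     ≡⟨ ℕ.+-identityʳ (t a) ⟩
  t a                         ∎

sum-𝟙≟ : ∀ {n} (a : Fin n) → sum (λ y → 𝟙 (y ≟ a)) ≡ 1
sum-𝟙≟ a = trans (sum-support _ a (λ y → 𝟙-no (y ≟ a))) (𝟙-yes (a ≟ a) refl)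

moved : ∀ {n} → (Fin n → Fin n) → Fin n → ℕ
moved f y = 𝟙 (¬? (f y ≟ y))

moved-≢ : ∀ {n} {f : Fin n → Fin n} {y} → f y ≢ y → moved f y ≡ 1
moved-≢ {f = f} {y} = 𝟙-yes (¬? (f y ≟ y))

moved-≡ : ∀ {n} {f : Fin n → Fin n} {y} → f y ≡ y → moved f y ≡ 0
moved-≡ {f = f} {y} e = 𝟙-no (¬? (f y ≟ y)) (λ ne → ne e)

moved-cong : ∀ {n} {f g : Fin n → Fin n} {y} → f y ≡ g y → moved f y ≡ moved g y
moved-cong {y = y} = cong (λ z → 𝟙 (¬? (z ≟ y)))

len≡∑moved : ∀ {n} (f : Fin n → Fin n) → len f ≡ sum (moved f)
len≡∑moved f = length-filter-tabulate (λ y → ¬? (f y ≟ y)) id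

len-cong : ∀ {n} {f g : Fin n → Fin n} → (∀ y → f y ≡ g y) → len f ≡ len g
len-cong {f = f} {g} f≗g = begin
  len f           ≡⟨ len≡∑moved f ⟩
  sum (moved f)   ≡⟨ sum-cong-≗ {x = moved f} {y = moved g} (moved-cong {f = f} {g} ∘ f≗g) ⟩
  sum (moved g)   ≡⟨ len≡∑moved g ⟨
  len g           ∎

len-id : ∀ {n} {f : Fin n → Fin n} → (∀ y → f y ≡ y) → len f ≡ 0
len-id {n} {f} f≗id = begin
  len f               ≡⟨ len≡∑moved f ⟩
  sum (moved f)       ≡⟨ sum-cong-≗ {x = moved f} {y = λ (_ : Fin _) → 0} (moved-≡ {f = f} ∘ f≗id) ⟩
  sum {n} (λ _ → 0)   ≡⟨ sum-replicate-zero n ⟩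
  0                   ∎

module _ {n : ℕ} where

  open import Data.List.Membership.DecPropositional (_≟_ {n}) using (_∈?_)

  sum-𝟙∈ : (xs : List (Fin n)) → Unique xs → (t : Fin n → ℕ) →
           sum (λ y → 𝟙 (y ∈? xs) * t y) ≡ ListAction.sum (List.map t xs)
  sum-𝟙∈ []       _              t = sum-replicate-zero n
  sum-𝟙∈ (x ∷ xs) (x∉xs ∷ xs!) t = begin
    sum (λ y → 𝟙 (y ∈? x ∷ xs) * t y)
      ≡⟨ sum-cong-≗ split ⟩
    sum (λ y → 𝟙 (y ≟ x) * t y + 𝟙 (y ∈? xs) * t y)
      ≡⟨ ∑-distrib-+ (λ y → 𝟙 (y ≟ x) * t y) (λ y → 𝟙 (y ∈? xs) * t y) ⟩
    sum (λ y → 𝟙 (y ≟ x) * t y) + sum (λ y → 𝟙 (y ∈? xs) * t y)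
      ≡⟨ cong₂ _+_ at-x (sum-𝟙∈ xs xs! t) ⟩
    t x + ListAction.sum (List.map t xs)
      ∎
    where
    x∉ : x ∉ xs
    x∉ x∈xs = All.lookup x∉xs x∈xs refl

    split-by : ∀ y → Dec (y ≡ x) → 𝟙 (y ∈? x ∷ xs) * t y ≡ 𝟙 (y ≟ x) * t y + 𝟙 (y ∈? xs) * t y
    split-by y (yes refl)
      rewrite 𝟙-yes (y ∈? x ∷ xs) (here refl) | 𝟙-yes (y ≟ y) refl | 𝟙-no (y ∈? xs) x∉ = sym (ℕ.+-identityʳ _)
    split-by y (no y≢x) = begin
      𝟙 (y ∈? x ∷ xs) * t y                     ≡⟨ cong (_* t y) (𝟙-cong (y ∈? x ∷ xs) (y ∈? xs) from-tail there) ⟩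
      𝟙 (y ∈? xs) * t y                         ≡⟨ cong (λ k → k * t y + 𝟙 (y ∈? xs) * t y) (𝟙-no (y ≟ x) y≢x) ⟨
      𝟙 (y ≟ x) * t y + 𝟙 (y ∈? xs) * t y       ∎
      where
      from-tail : y ∈ x ∷ xs → y ∈ xs
      from-tail (here y≡x) = contradiction y≡x y≢x
      from-tail (there y∈xs) = y∈xs

    split : ∀ y → 𝟙 (y ∈? x ∷ xs) * t y ≡ 𝟙 (y ≟ x) * t y + 𝟙 (y ∈? xs) * t y
    split y = split-by y (y ≟ x)

    at-x : sum (λ y → 𝟙 (y ≟ x) * t y) ≡ t x
    at-x = begin
      sum (λ y → 𝟙 (y ≟ x) * t y) ≡⟨ sum-support _ x (λ y y≢x → cong (_* t y) (𝟙-no (y ≟ x) y≢x)) ⟩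
      𝟙 (x ≟ x) * t x            ≡⟨ cong (_* t x) (𝟙-yes (x ≟ x) refl) ⟩
      1 * t x                     ≡⟨ ℕ.*-identityˡ (t x) ⟩
      t x                         ∎

  len-agree-off : ∀ {f g : Fin n → Fin n} (xs : List (Fin n)) → Unique xs →
                  (∀ y → y ∉ xs → f y ≡ g y) →
                  len f + ListAction.sum (List.map (moved g) xs) ≡ len g + ListAction.sum (List.map (moved f) xs)
  len-agree-off {f} {g} xs xs! agree = begin
    len f + ListAction.sum (List.map (moved g) xs)
      ≡⟨ cong₂ _+_ (len≡∑moved f) (sym (sum-𝟙∈ xs xs! (moved g))) ⟩
    sum (moved f) + sum (λ y → 𝟙 (y ∈? xs) * moved g y)
      ≡⟨ ∑-distrib-+ (moved f) _ ⟨
    sum (λ y → moved f y + 𝟙 (y ∈? xs) * moved g y)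
      ≡⟨ sum-cong-≗ pointwise ⟩
    sum (λ y → moved g y + 𝟙 (y ∈? xs) * moved f y)
      ≡⟨ ∑-distrib-+ (moved g) _ ⟩
    sum (moved g) + sum (λ y → 𝟙 (y ∈? xs) * moved f y)
      ≡⟨ cong₂ _+_ (sym (len≡∑moved g)) (sum-𝟙∈ xs xs! (moved f)) ⟩
    len g + ListAction.sum (List.map (moved f) xs)
      ∎
    where
    swap : ∀ a b → a + 1 * b ≡ b + 1 * a
    swap = solve-∀

    pointwise : ∀ y → moved f y + 𝟙 (y ∈? xs) * moved g y ≡ moved g y + 𝟙 (y ∈? xs) * moved f y
    pointwise y with y ∈? xs
    ... | yes _   = swap (moved f y) (moved g y)
    ... | no y∉xs = cong (_+ 0) (moved-cong {f = f} {g} (agree y y∉xs))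

-- σ x ≢ τ x iff σ⁻¹τ moves σ x; reindex the sum by σ.
hd≡len[σ⁻¹τ] : ∀ {n} (σ τ : Permutation′ n) → hd (σ ⟨$⟩ʳ_) (τ ⟨$⟩ʳ_) ≡ len ((flip σ ∘ₚ τ) ⟨$⟩ʳ_)
hd≡len[σ⁻¹τ] σ τ = begin
  hd (σ ⟨$⟩ʳ_) (τ ⟨$⟩ʳ_)                    ≡⟨ length-filter-tabulate (λ x → ¬? (σ ⟨$⟩ʳ x ≟ τ ⟨$⟩ʳ x)) id ⟩
  sum (λ x → 𝟙 (¬? (σ ⟨$⟩ʳ x ≟ τ ⟨$⟩ʳ x)))   ≡⟨ sum-cong-≗ differs⇔moved ⟩
  sum (λ x → moved α (σ ⟨$⟩ʳ x))             ≡⟨ sum-permute (moved α) σ ⟨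
  sum (moved α)                             ≡⟨ len≡∑moved α ⟨
  len α                                     ∎
  where
  α = (flip σ ∘ₚ τ) ⟨$⟩ʳ_
  α∘σ : ∀ x → α (σ ⟨$⟩ʳ x) ≡ τ ⟨$⟩ʳ x
  α∘σ x = cong (τ ⟨$⟩ʳ_) (inverseˡ σ)
  differs⇔moved : ∀ x → 𝟙 (¬? (σ ⟨$⟩ʳ x ≟ τ ⟨$⟩ʳ x)) ≡ moved α (σ ⟨$⟩ʳ x)
  differs⇔moved x = 𝟙-cong (¬? (σ ⟨$⟩ʳ x ≟ τ ⟨$⟩ʳ x)) (¬? (α (σ ⟨$⟩ʳ x) ≟ σ ⟨$⟩ʳ x))
    (λ ne e → ne (trans (sym e) (α∘σ x))) (λ ne e → ne (trans (α∘σ x) (sym e)))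

⟨$⟩ʳ-injective : ∀ {n} (π : Permutation′ n) {x y} → π ⟨$⟩ʳ x ≡ π ⟨$⟩ʳ y → x ≡ y
⟨$⟩ʳ-injective π {x} {y} e = begin
  x                       ≡⟨ inverseˡ π ⟨
  π ⟨$⟩ˡ (π ⟨$⟩ʳ x)        ≡⟨ cong (π ⟨$⟩ˡ_) e ⟩
  π ⟨$⟩ˡ (π ⟨$⟩ʳ y)        ≡⟨ inverseˡ π ⟩
  y                       ∎

¬Odd0 : ¬ Odd 0
¬Odd0 (_ , ())

module Orbits {n : ℕ} (β : Permutation′ n) where

  private
    b : Fin n → Fin n
    b = β ⟨$⟩ʳ_

  iter-+ : ∀ i j x → iter b (i + j) x ≡ iter b i (iter b j x)
  iter-+ zero    j x = refl
  iter-+ (suc i) j x = cong b (iter-+ i j x)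

  iter-comm : ∀ i j x → iter b i (iter b j x) ≡ iter b j (iter b i x)
  iter-comm i j x = begin
    iter b i (iter b j x)   ≡⟨ iter-+ i j x ⟨
    iter b (i + j) x        ≡⟨ cong (λ k → iter b k x) (ℕ.+-comm i j) ⟩
    iter b (j + i) x        ≡⟨ iter-+ j i x ⟩
    iter b j (iter b i x)   ∎

  iter-injective : ∀ j {x y} → iter b j x ≡ iter b j y → x ≡ y
  iter-injective zero    e = e
  iter-injective (suc j) e = iter-injective j (⟨$⟩ʳ-injective β e)

  -- Two of the n + 1 points x, b x, …, bⁿ x coincide.
  period : ∀ x → ∃[ p ] (0 < p × iter b p x ≡ x)
  period x with Fin.pigeonhole (ℕ.n<1+n n) (λ (i : Fin (suc n)) → iter b (toℕ i) x)
  ... | i , j , i<j , e = toℕ j ∸ toℕ i , ℕ.m<n⇒0<n∸m i<j , iter-injective (toℕ i) shifted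
    where
    shifted : iter b (toℕ i) (iter b (toℕ j ∸ toℕ i) x) ≡ iter b (toℕ i) x
    shifted = begin
      iter b (toℕ i) (iter b (toℕ j ∸ toℕ i) x)   ≡⟨ iter-comm (toℕ i) (toℕ j ∸ toℕ i) x ⟩
      iter b (toℕ j ∸ toℕ i) (iter b (toℕ i) x)   ≡⟨ iter-+ (toℕ j ∸ toℕ i) (toℕ i) x ⟨
      iter b (toℕ j ∸ toℕ i + toℕ i) x            ≡⟨ cong (λ k → iter b k x) (ℕ.m∸n+n≡m (ℕ.<⇒≤ i<j)) ⟩
      iter b (toℕ j) x                            ≡⟨ e ⟨
      iter b (toℕ i) x                            ∎

  iter-*-period : ∀ {p x} → iter b p x ≡ x → ∀ s → iter b (s * p) x ≡ x
  iter-*-period e zero = refl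
  iter-*-period {p} {x} e (suc s) = begin
    iter b (p + s * p) x        ≡⟨ iter-+ p (s * p) x ⟩
    iter b p (iter b (s * p) x) ≡⟨ cong (iter b p) (iter-*-period e s) ⟩
    iter b p x                  ≡⟨ e ⟩
    x                           ∎

  orbit-refl : ∀ x → InOrbit β x x
  orbit-refl x = 0 , refl

  orbit-step : ∀ {x y} → InOrbit β x y → InOrbit β x (b y)
  orbit-step (j , e) = suc j , cong b e

  orbit-trans : ∀ {x y z} → InOrbit β x y → InOrbit β y z → InOrbit β x z
  orbit-trans {x} (i , refl) (j , refl) = j + i , iter-+ j i x

  orbit-sym : ∀ {x y} → InOrbit β x y → InOrbit β y x
  orbit-sym {x} (i , refl) with period x
  ... | suc p , _ , e = p * i , (begin
    iter b (p * i) (iter b i x)   ≡⟨ iter-+ (p * i) i x ⟨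
    iter b (p * i + i) x          ≡⟨ cong (λ k → iter b k x) (ℕ.+-comm (p * i) i) ⟩
    iter b (suc p * i) x          ≡⟨ cong (λ k → iter b k x) (ℕ.*-comm (suc p) i) ⟩
    iter b (i * suc p) x          ≡⟨ iter-*-period e i ⟩
    x                             ∎)

  -- Within one period every point of the orbit is reached.
  orbit? : ∀ x y → Dec (InOrbit β x y)
  orbit? x y with period x
  ... | suc p , _ , e with Fin.any? (λ (i : Fin (suc p)) → iter b (toℕ i) x ≟ y)
  ...   | yes (i , e′) = yes (toℕ i , e′)
  ...   | no ¬early = no λ { (j , e′) → ¬early (fromℕ< (m%n<n j (suc p)) , reduce j e′) }
    where
    reduce : ∀ j → iter b j x ≡ y → iter b (toℕ (fromℕ< (m%n<n j (suc p)))) x ≡ y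
    reduce j e′ = begin
      iter b (toℕ (fromℕ< (m%n<n j (suc p)))) x          ≡⟨ cong (λ k → iter b k x) (Fin.toℕ-fromℕ< (m%n<n j (suc p))) ⟩
      iter b (j % suc p) x                               ≡⟨ cong (iter b (j % suc p)) (iter-*-period e (j / suc p)) ⟨
      iter b (j % suc p) (iter b (j / suc p * suc p) x)  ≡⟨ iter-+ (j % suc p) _ x ⟨
      iter b (j % suc p + j / suc p * suc p) x           ≡⟨ cong (λ k → iter b k x) (m≡m%n+[m/n]*n j (suc p)) ⟨
      iter b j x                                         ≡⟨ e′ ⟩
      y                                                  ∎

  orbit-ind : (P : Fin n → Set) → ∀ {x y} → P x → (∀ z → P z → P (b z)) → InOrbit β x y → P y
  orbit-ind P px step (zero , refl)  = px
  orbit-ind P px step (suc j , refl) = step _ (orbit-ind P px step (j , refl))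

  reaches-fixed : ∀ {s x} j → b s ≡ s → iter b j x ≡ s → x ≡ s
  reaches-fixed zero    _  e = e
  reaches-fixed (suc j) fs e = reaches-fixed j fs (⟨$⟩ʳ-injective β (trans e (sym fs)))

  orbit-of-fixed : ∀ {x y} → b x ≡ x → InOrbit β x y → y ≡ x
  orbit-of-fixed {x} fx = orbit-ind (_≡ x) refl (λ z z≡x → trans (cong b z≡x) fx)

  orbit-size : Fin n → ℕ
  orbit-size x = sum (λ y → 𝟙 (orbit? x y))

  orbit-size-fixed : ∀ {s} → b s ≡ s → orbit-size s ≡ 1
  orbit-size-fixed {s} fs = begin
    orbit-size s          ≡⟨ sum-support _ s (λ y y≢s → 𝟙-no (orbit? s y) (y≢s ∘ orbit-of-fixed fs)) ⟩
    𝟙 (orbit? s s)        ≡⟨ 𝟙-yes (orbit? s s) (orbit-refl s) ⟩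
    1                     ∎

  module _ {x : Fin n} {ρ : Fin n → Fin n} (cyc : IsCycleOf β x ρ) where

    cycle-support : ∀ {y} → ρ y ≢ y → InOrbit β x y
    cycle-support {y} ρy≢y with orbit? x y
    ... | yes o  = o
    ... | no ¬o  = contradiction (proj₂ (cyc y) ¬o) ρy≢y

    cycle-fixes : ∀ {s} → b s ≡ s → ρ s ≡ s
    cycle-fixes {s} fs with orbit? x s
    ... | yes o = trans (proj₁ (cyc s) o) fs
    ... | no ¬o = proj₂ (cyc s) ¬o

    cycle-trivial : ∀ {s} → InOrbit β x s → b s ≡ s → ∀ y → ρ y ≡ y
    cycle-trivial (j , o) fs y with reaches-fixed j fs o
    ... | refl with orbit? x y
    ...   | yes x⇝y = let y≡x = orbit-of-fixed fs x⇝y in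
                      trans (proj₁ (cyc y) x⇝y) (trans (cong b y≡x) (trans fs (sym y≡x)))
    ...   | no ¬x⇝y = proj₂ (cyc y) ¬x⇝y

    cycle-len : ∀ {s} → ρ s ≢ s → len ρ ≡ orbit-size s
    cycle-len {s} ρs≢s = begin
      len ρ                             ≡⟨ len≡∑moved ρ ⟩
      sum (moved ρ)                     ≡⟨ sum-cong-≗ {x = moved ρ} {y = λ y → 𝟙 (orbit? s y)} same ⟩
      orbit-size s                      ∎
      where
      x⇝s : InOrbit β x s
      x⇝s = cycle-support ρs≢s
      no-fixed : ∀ {y} → InOrbit β s y → b y ≢ y
      no-fixed (j , o) fy with reaches-fixed j fy o
      ... | refl = ρs≢s (cycle-fixes fy)
      same : ∀ y → moved ρ y ≡ 𝟙 (orbit? s y)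
      same y = 𝟙-cong (¬? (ρ y ≟ y)) (orbit? s y)
        (λ ρy≢y → orbit-trans (orbit-sym x⇝s) (cycle-support ρy≢y))
        (λ s⇝y ρy≡y → no-fixed s⇝y (trans (sym (proj₁ (cyc y) (orbit-trans x⇝s s⇝y))) ρy≡y))

  odd-cycle-moves : ∀ {x ρ y} → IsCycleOf β x ρ → Odd (len ρ) → InOrbit β x y → ρ y ≢ y
  odd-cycle-moves {y = y} cyc odd x⇝y ρy≡y =
    ¬Odd0 (subst Odd (len-id (cycle-trivial cyc x⇝y (trans (sym (proj₁ (cyc y) x⇝y)) ρy≡y))) odd)

  cycle-unique : ∀ {x₁ x₂ ρ₁ ρ₂ s} → IsCycleOf β x₁ ρ₁ → IsCycleOf β x₂ ρ₂ →
                 ρ₁ s ≢ s → ρ₂ s ≢ s → ∀ y → ρ₁ y ≡ ρ₂ y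
  cycle-unique {x₁} {x₂} c₁ c₂ m₁ m₂ y with orbit? x₁ y
  ... | yes o = trans (proj₁ (c₁ y) o) (sym (proj₁ (c₂ y) (x₁⇝x₂ o)))
    where x₁⇝x₂ = orbit-trans (orbit-trans (cycle-support c₂ m₂) (orbit-sym (cycle-support c₁ m₁)))
  ... | no ¬o = trans (proj₂ (c₁ y) ¬o) (sym (proj₂ (c₂ y) (¬o ∘ x₂⇝x₁)))
    where x₂⇝x₁ = orbit-trans (orbit-trans (cycle-support c₁ m₁) (orbit-sym (cycle-support c₂ m₂)))

cycle-transfer : ∀ {n} {α β : Permutation′ n} {x ρ} → IsCycleOf β x ρ →
                 (∀ y → InOrbit β x y → α ⟨$⟩ʳ y ≡ β ⟨$⟩ʳ y) → IsCycleOf α x ρ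
cycle-transfer {α = α} {β} {x} {ρ} cyc agree y =
  (λ o → trans (proj₁ (cyc y) (to o)) (sym (agree y (to o)))) , (λ ¬o → proj₂ (cyc y) (¬o ∘ from))
  where
  same-iter : ∀ j → iter (α ⟨$⟩ʳ_) j x ≡ iter (β ⟨$⟩ʳ_) j x
  same-iter zero    = refl
  same-iter (suc j) = trans (cong (α ⟨$⟩ʳ_) (same-iter j)) (agree _ (j , refl))
  to : InOrbit α x y → InOrbit β x y
  to (j , e) = j , trans (sym (same-iter j)) e
  from : InOrbit β x y → InOrbit α x y
  from (j , e) = j , trans (same-iter j) e

cycle-cong : ∀ {n} {β : Permutation′ n} {x ρ ρ′} → IsCycleOf β x ρ → (∀ y → ρ y ≡ ρ′ y) → IsCycleOf β x ρ′
cycle-cong cyc e y = (λ o → trans (sym (e y)) (proj₁ (cyc y) o)) , (λ ¬o → trans (sym (e y)) (proj₂ (cyc y) ¬o))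

below-last : ∀ {k} (y : Fin (suc k)) → y ≢ fromℕ k → ∃[ z ] inject₁ z ≡ y
below-last {k} y y≢k =
  lower₁ y (λ e → y≢k (Fin.toℕ-injective (trans (sym e) (sym (Fin.toℕ-fromℕ k))))) , Fin.inject₁-lower₁ y _

-- ext id exposes inject₁ ∘ low, which Defs keeps private.
ext-id : ∀ {k} (y : Fin (suc k)) → y ≢ fromℕ k → ext {k} id y ≡ y
ext-id {k} y y≢k with y ≟ fromℕ k
... | yes y≡k = contradiction y≡k y≢k
ext-id {zero}  zero    y≢k | no _ = contradiction refl y≢k
ext-id {suc k} zero    y≢k | no _ = refl
ext-id {suc k} (suc y) y≢k | no _ with y ≟ fromℕ k | ext-id y (y≢k ∘ cong suc)
... | yes y≡k | _  = contradiction (cong suc y≡k) y≢k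
... | no _    | ih = cong suc ih

ext-last : ∀ {k} (ρ : Fin k → Fin k) → ext ρ (fromℕ k) ≡ fromℕ k
ext-last {k} ρ with fromℕ k ≟ fromℕ k
... | yes _ = refl
... | no ne = contradiction refl ne

ext-inject₁ : ∀ {k} (ρ : Fin k → Fin k) (z : Fin k) → ext ρ (inject₁ z) ≡ inject₁ (ρ z)
ext-inject₁ {k} ρ z with inject₁ z ≟ fromℕ k | ext-id {k} (inject₁ z)
... | yes z≡k | _  = contradiction (sym z≡k) Fin.fromℕ≢inject₁
... | no z≢k  | ih = cong (λ w → inject₁ (ρ w)) (Fin.inject₁-injective (ih z≢k))

ext-∘-inverse : ∀ {k} {f g : Fin k → Fin k} → (∀ z → f (g z) ≡ z) → ∀ y → ext f (ext g y) ≡ y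
ext-∘-inverse {k} {f} {g} fg y = by-cases (y ≟ fromℕ k)
  where
  by-cases : Dec (y ≡ fromℕ k) → ext f (ext g y) ≡ y
  by-cases (yes refl) = trans (cong (ext f) (ext-last g)) (ext-last f)
  by-cases (no y≢k) with below-last y y≢k
  ... | z , refl = trans (cong (ext f) (ext-inject₁ g z)) (trans (ext-inject₁ f (g z)) (cong inject₁ (fg z)))

extend : ∀ {k} → Permutation′ k → Permutation′ (suc k)
extend π = permutation (ext (π ⟨$⟩ʳ_)) (ext (π ⟨$⟩ˡ_))
  (ext-∘-inverse (λ _ → inverseʳ π)) (ext-∘-inverse (λ _ → inverseˡ π))

ext-injective : ∀ {k} (γ₁ γ₂ : Fin k → Fin k) → (∀ y → ext γ₁ y ≡ ext γ₂ y) → ∀ z → γ₁ z ≡ γ₂ z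
ext-injective γ₁ γ₂ e z =
  Fin.inject₁-injective (trans (sym (ext-inject₁ γ₁ z)) (trans (e (inject₁ z)) (ext-inject₁ γ₂ z)))

len-ext : ∀ {k} (ρ : Fin k → Fin k) → len (ext ρ) ≡ len ρ
len-ext {k} ρ = begin
  len (ext ρ)                                        ≡⟨ len≡∑moved (ext ρ) ⟩
  sum (moved (ext ρ))                                ≡⟨ sum-init-last (moved (ext ρ)) ⟩
  sum (moved (ext ρ) ∘ inject₁) + moved (ext ρ) (fromℕ k)
    ≡⟨ cong₂ _+_ (sum-cong-≗ {x = moved (ext ρ) ∘ inject₁} {y = moved ρ} at-inject₁) (moved-≡ {f = ext ρ} (ext-last ρ)) ⟩
  sum (moved ρ) + 0                                  ≡⟨ ℕ.+-identityʳ _ ⟩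
  sum (moved ρ)                                      ≡⟨ len≡∑moved ρ ⟨
  len ρ                                              ∎
  where
  at-inject₁ : ∀ z → moved (ext ρ) (inject₁ z) ≡ moved ρ z
  at-inject₁ z = 𝟙-cong (¬? (ext ρ (inject₁ z) ≟ inject₁ z)) (¬? (ρ z ≟ z))
    (λ ne e → ne (trans (ext-inject₁ ρ z) (cong inject₁ e)))
    (λ ne e → ne (Fin.inject₁-injective (trans (sym (ext-inject₁ ρ z)) e)))

iter-ext : ∀ {k} (α : Permutation′ k) j z →
           iter (extend α ⟨$⟩ʳ_) j (inject₁ z) ≡ inject₁ (iter (α ⟨$⟩ʳ_) j z)
iter-ext α zero    z = refl
iter-ext α (suc j) z = trans (cong (ext (α ⟨$⟩ʳ_)) (iter-ext α j z)) (ext-inject₁ (α ⟨$⟩ʳ_) _)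

cycle-ext : ∀ {k} {α : Permutation′ k} {z γ} → IsCycleOf α z γ → IsCycleOf (extend α) (inject₁ z) (ext γ)
cycle-ext {k} {α} {z} {γ} cyc y = by-cases (y ≟ fromℕ k)
  where
  by-cases : Dec (y ≡ fromℕ k) →
             (InOrbit (extend α) (inject₁ z) y → ext γ y ≡ ext (α ⟨$⟩ʳ_) y) × (¬ InOrbit (extend α) (inject₁ z) y → ext γ y ≡ y)
  by-cases (yes refl) = (λ { (j , e) → contradiction (trans (sym e) (iter-ext α j z)) Fin.fromℕ≢inject₁ }) , (λ _ → ext-last γ)
  by-cases (no y≢k) with below-last y y≢k
  ... | w , refl = on-orbit , off-orbit
    where
    on-orbit : InOrbit (extend α) (inject₁ z) (inject₁ w) → ext γ (inject₁ w) ≡ ext (α ⟨$⟩ʳ_) (inject₁ w)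
    on-orbit (j , e) = begin
      ext γ (inject₁ w)          ≡⟨ ext-inject₁ γ w ⟩
      inject₁ (γ w)              ≡⟨ cong inject₁ (proj₁ (cyc w) (j , Fin.inject₁-injective (trans (sym (iter-ext α j z)) e))) ⟩
      inject₁ (α ⟨$⟩ʳ w)          ≡⟨ ext-inject₁ (α ⟨$⟩ʳ_) w ⟨
      ext (α ⟨$⟩ʳ_) (inject₁ w)   ∎
    off-orbit : ¬ InOrbit (extend α) (inject₁ z) (inject₁ w) → ext γ (inject₁ w) ≡ inject₁ w
    off-orbit ¬o = trans (ext-inject₁ γ w) (cong inject₁ (proj₂ (cyc w) (λ { (j , e) → ¬o (j , trans (iter-ext α j z) (cong inject₁ e)) })))

module _ {k : ℕ} (σ : Permutation′ (suc k)) where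

  contraction-at-preimage : ∀ z → σ ⟨$⟩ʳ inject₁ z ≡ fromℕ k → inject₁ (contraction σ ⟨$⟩ʳ z) ≡ σ ⟨$⟩ʳ fromℕ k
  contraction-at-preimage z σz≡k with σ ⟨$⟩ʳ inject₁ z ≟ fromℕ k
  ... | no σz≢k = contradiction σz≡k σz≢k
  ... | yes _ with σ ⟨$⟩ʳ fromℕ k ≟ fromℕ k | ext-id (σ ⟨$⟩ʳ fromℕ k)
  ...   | yes σk≡k | _ = contradiction (⟨$⟩ʳ-injective σ (trans σk≡k (sym σz≡k))) Fin.fromℕ≢inject₁
  ...   | no σk≢k  | ext-id-σk = ext-id-σk σk≢k

  contraction-elsewhere : ∀ z → σ ⟨$⟩ʳ inject₁ z ≢ fromℕ k → inject₁ (contraction σ ⟨$⟩ʳ z) ≡ σ ⟨$⟩ʳ inject₁ z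
  contraction-elsewhere z σz≢k with σ ⟨$⟩ʳ inject₁ z ≟ fromℕ k | ext-id (σ ⟨$⟩ʳ inject₁ z)
  ... | yes σz≡k | _ = contradiction σz≡k σz≢k
  ... | no _     | ext-id-σz = ext-id-σz σz≢k

module ContractionOfQuotient {k : ℕ} (σ τ : Permutation′ (suc k)) where

  α A : Permutation′ (suc k)
  α = flip σ ∘ₚ τ
  A = extend (flip (contraction σ) ∘ₚ contraction τ)

  m u c : Fin (suc k)
  m = fromℕ k
  u = σ ⟨$⟩ʳ m
  c = σ ⟨$⟩ʳ (τ ⟨$⟩ˡ m)

  α-c : α ⟨$⟩ʳ c ≡ m
  α-c = trans (cong (τ ⟨$⟩ʳ_) (inverseˡ σ)) (inverseʳ τ)

  α-u : α ⟨$⟩ʳ u ≡ τ ⟨$⟩ʳ m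
  α-u = cong (τ ⟨$⟩ʳ_) (inverseˡ σ)

  A-m : A ⟨$⟩ʳ m ≡ m
  A-m = ext-last _

  private
    σ⁻¹≡m⇒≡u : ∀ {y} → σ ⟨$⟩ˡ y ≡ m → y ≡ u
    σ⁻¹≡m⇒≡u e = trans (sym (inverseʳ σ)) (cong (σ ⟨$⟩ʳ_) e)

    σ⁻¹u≡m : ∀ {y} → y ≡ u → σ ⟨$⟩ˡ y ≡ m
    σ⁻¹u≡m refl = inverseˡ σ

    A-τ≢m : ∀ z {v} → inject₁ (contraction σ ⟨$⟩ˡ z) ≡ v → τ ⟨$⟩ʳ v ≢ m → A ⟨$⟩ʳ inject₁ z ≡ τ ⟨$⟩ʳ v
    A-τ≢m z refl τv≢m = trans (ext-inject₁ _ z) (contraction-elsewhere τ _ τv≢m)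

    A-τ≡m : ∀ z {v} → inject₁ (contraction σ ⟨$⟩ˡ z) ≡ v → τ ⟨$⟩ʳ v ≡ m → A ⟨$⟩ʳ inject₁ z ≡ τ ⟨$⟩ʳ m
    A-τ≡m z refl τv≡m = trans (ext-inject₁ _ z) (contraction-at-preimage τ _ τv≡m)

  A≡α-elsewhere : ∀ y → y ≢ m → y ≢ u → y ≢ c → A ⟨$⟩ʳ y ≡ α ⟨$⟩ʳ y
  A≡α-elsewhere y y≢m y≢u y≢c with below-last y y≢m
  ... | z , refl = A-τ≢m z (contraction-elsewhere (flip σ) z (y≢u ∘ σ⁻¹≡m⇒≡u))
                     (λ αy≡m → y≢c (⟨$⟩ʳ-injective α (trans αy≡m (sym α-c))))

  A-c : c ≢ m → c ≢ u → A ⟨$⟩ʳ c ≡ α ⟨$⟩ʳ u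
  A-c c≢m c≢u with below-last c c≢m
  ... | z , z≡c = begin
    A ⟨$⟩ʳ c             ≡⟨ cong (A ⟨$⟩ʳ_) z≡c ⟨
    A ⟨$⟩ʳ inject₁ z     ≡⟨ A-τ≡m z (contraction-elsewhere (flip σ) z (c≢u ∘ σ⁻¹≡m⇒≡u ∘ subst (λ y → σ ⟨$⟩ˡ y ≡ m) z≡c))
                                 (trans (cong (α ⟨$⟩ʳ_) z≡c) α-c) ⟩
    τ ⟨$⟩ʳ m             ≡⟨ α-u ⟨
    α ⟨$⟩ʳ u             ∎

  A-u : u ≢ m → c ≢ m → A ⟨$⟩ʳ u ≡ α ⟨$⟩ʳ m
  A-u u≢m c≢m with below-last u u≢m
  ... | z , z≡u = trans (cong (A ⟨$⟩ʳ_) (sym z≡u))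
    (A-τ≢m z (contraction-at-preimage (flip σ) z (σ⁻¹u≡m z≡u))
      (λ αm≡m → c≢m (sym (⟨$⟩ʳ-injective α (trans αm≡m (sym α-c))))))

  A-u-when-c≡m : u ≢ m → c ≡ m → A ⟨$⟩ʳ u ≡ α ⟨$⟩ʳ u
  A-u-when-c≡m u≢m c≡m with below-last u u≢m
  ... | z , z≡u = trans (cong (A ⟨$⟩ʳ_) (sym z≡u))
    (trans (A-τ≡m z (contraction-at-preimage (flip σ) z (σ⁻¹u≡m z≡u)) (trans (cong (α ⟨$⟩ʳ_) (sym c≡m)) α-c))
      (sym α-u))

transpose-at : ∀ {n} (i j : Fin n) → transpose i j ⟨$⟩ʳ i ≡ j
transpose-at i j rewrite dec-true (i ≟ i) refl = refl

transpose-off : ∀ {n} (i j k : Fin n) → k ≢ i → k ≢ j → transpose i j ⟨$⟩ʳ k ≡ k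
transpose-off i j k k≢i k≢j rewrite dec-false (k ≟ i) k≢i | dec-false (k ≟ j) k≢j = refl

put-last : ∀ {r} (j : Fin r) →
           ∃[ p ] (∀ (i : Fin r) → (suc (toℕ i) ≡ r → p ⟨$⟩ʳ i ≡ j) × (suc (toℕ i) < r → p ⟨$⟩ʳ i ≢ j))
put-last {suc r} j = t , λ i → at-last i , before-last i
  where
  t = transpose (fromℕ r) j
  is-last : ∀ i → suc (toℕ i) ≡ suc r → i ≡ fromℕ r
  is-last i e = Fin.toℕ-injective (trans (ℕ.suc-injective e) (sym (Fin.toℕ-fromℕ r)))
  at-last : ∀ i → suc (toℕ i) ≡ suc r → t ⟨$⟩ʳ i ≡ j
  at-last i e = trans (cong (t ⟨$⟩ʳ_) (is-last i e)) (transpose-at (fromℕ r) j)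
  before-last : ∀ i → suc (toℕ i) < suc r → t ⟨$⟩ʳ i ≢ j
  before-last i lt e = ℕ.<-irrefl (trans (cong toℕ (⟨$⟩ʳ-injective t (trans e (sym (transpose-at (fromℕ r) j)))))
                                        (Fin.toℕ-fromℕ r))
                                  (ℕ.≤-pred lt)

module PutLast {r} (j : Fin r) where

  p : Permutation′ r
  p = proj₁ (put-last j)

  p-last : ∀ i → suc (toℕ i) ≡ r → p ⟨$⟩ʳ i ≡ j
  p-last i = proj₁ (proj₂ (put-last j) i)

  p-init : ∀ i → suc (toℕ i) < r → p ⟨$⟩ʳ i ≢ j
  p-init i = proj₂ (proj₂ (put-last j) i)

put-last-two : ∀ {r} (a b : Fin r) → a ≢ b →
  ∃[ p ] (∀ (i : Fin r) → (toℕ i + 2 ≡ r → p ⟨$⟩ʳ i ≡ a) × (toℕ i + 1 ≡ r → p ⟨$⟩ʳ i ≡ b)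
                          × (toℕ i + 2 < r → p ⟨$⟩ʳ i ≢ a) × (toℕ i + 2 < r → p ⟨$⟩ʳ i ≢ b))
put-last-two {suc zero} zero zero a≢b = contradiction refl a≢b
put-last-two {suc (suc r)} a b a≢b = p , λ i →
  (λ e → trans (cong (p ⟨$⟩ʳ_) (is-penultimate i e)) p-penultimate) ,
  (λ e → trans (cong (p ⟨$⟩ʳ_) (is-last i e)) p-last) ,
  (λ lt e → ≢-penultimate i lt (⟨$⟩ʳ-injective p (trans e (sym p-penultimate)))) ,
  (λ lt e → ≢-last i lt (⟨$⟩ʳ-injective p (trans e (sym p-last))))
  where
  L L′ : Fin (suc (suc r))
  L  = fromℕ (suc r)
  L′ = inject₁ (fromℕ r)
  toℕ-L′ : toℕ L′ ≡ r
  toℕ-L′ = trans (Fin.toℕ-inject₁ (fromℕ r)) (Fin.toℕ-fromℕ r)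
  q = transpose L b
  a′ = q ⟨$⟩ˡ a
  p = transpose L′ a′ ∘ₚ q
  L≢L′ : L ≢ L′
  L≢L′ e = ℕ.<-irrefl (trans (sym toℕ-L′) (trans (cong toℕ (sym e)) (Fin.toℕ-fromℕ (suc r)))) (ℕ.n<1+n r)
  L≢a′ : L ≢ a′
  L≢a′ e = a≢b (trans (sym (inverseʳ q)) (trans (cong (q ⟨$⟩ʳ_) (sym e)) (transpose-at L b)))
  p-last : p ⟨$⟩ʳ L ≡ b
  p-last = trans (cong (q ⟨$⟩ʳ_) (transpose-off L′ a′ L L≢L′ L≢a′)) (transpose-at L b)
  p-penultimate : p ⟨$⟩ʳ L′ ≡ a
  p-penultimate = trans (cong (q ⟨$⟩ʳ_) (transpose-at L′ a′)) (inverseʳ q)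
  is-last : ∀ i → toℕ i + 1 ≡ suc (suc r) → i ≡ L
  is-last i e = Fin.toℕ-injective (trans (ℕ.suc-injective (trans (ℕ.+-comm 1 (toℕ i)) e)) (sym (Fin.toℕ-fromℕ (suc r))))
  is-penultimate : ∀ i → toℕ i + 2 ≡ suc (suc r) → i ≡ L′
  is-penultimate i e = Fin.toℕ-injective (trans (ℕ.suc-injective (ℕ.suc-injective (trans (ℕ.+-comm 2 (toℕ i)) e))) (sym toℕ-L′))
  below : ∀ i → toℕ i + 2 < suc (suc r) → toℕ i < r
  below i lt = ℕ.≤-pred (ℕ.≤-pred (ℕ.≤-trans (ℕ.≤-reflexive (cong suc (ℕ.+-comm 2 (toℕ i)))) lt))
  ≢-last : ∀ i → toℕ i + 2 < suc (suc r) → i ≢ L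
  ≢-last i lt refl = ℕ.<-irrefl refl (ℕ.<-trans (ℕ.n<1+n r) (subst (_< r) (Fin.toℕ-fromℕ (suc r)) (below i lt)))
  ≢-penultimate : ∀ i → toℕ i + 2 < suc (suc r) → i ≢ L′
  ≢-penultimate i lt refl = ℕ.<-irrefl toℕ-L′ (below i lt)

module PutLastTwo {r} (a b : Fin r) (a≢b : a ≢ b) where

  p : Permutation′ r
  p = proj₁ (put-last-two a b a≢b)

  p-penultimate : ∀ i → toℕ i + 2 ≡ r → p ⟨$⟩ʳ i ≡ a
  p-penultimate i = proj₁ (proj₂ (put-last-two a b a≢b) i)

  p-last : ∀ i → toℕ i + 1 ≡ r → p ⟨$⟩ʳ i ≡ b
  p-last i = proj₁ (proj₂ (proj₂ (put-last-two a b a≢b) i))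

  p-init-≢a : ∀ i → toℕ i + 2 < r → p ⟨$⟩ʳ i ≢ a
  p-init-≢a i = proj₁ (proj₂ (proj₂ (proj₂ (put-last-two a b a≢b) i)))

  p-init-≢b : ∀ i → toℕ i + 2 < r → p ⟨$⟩ʳ i ≢ b
  p-init-≢b i = proj₂ (proj₂ (proj₂ (proj₂ (put-last-two a b a≢b) i)))

least-witness : ∀ {p} (P : ℕ → Set p) → (∀ j → Dec (P j)) → ∀ n → P n → ∃[ t ] (P t × (∀ j → j < t → ¬ P j))
least-witness P P? zero    P0 = 0 , P0 , λ _ ()
least-witness P P? (suc n) Pn with P? 0
... | yes P0 = 0 , P0 , λ _ ()
... | no ¬P0 with least-witness (P ∘ suc) (P? ∘ suc) n Pn
...   | t , Pt , below = suc t , Pt , λ { zero _ → ¬P0 ; (suc j) (s≤s j<t) → below j j<t }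

odd+2 : ∀ {a} → Odd a → Odd (a + 2)
odd+2 (j , refl) = j + 1 , shift j
  where
  shift : ∀ j → suc (2 * j) + 2 ≡ suc (2 * (j + 1))
  shift = solve-∀

odd-merge : ∀ {a b} → Odd a → Odd b → Odd (1 + a + b)
odd-merge (i , refl) (j , refl) = i + j + 1 , merge i j
  where
  merge : ∀ i j → 1 + suc (2 * i) + suc (2 * j) ≡ suc (2 * (i + j + 1))
  merge = solve-∀

suc<+2 : ∀ t → suc t < t + 2
suc<+2 t = subst (suc t <_) (ℕ.+-comm 2 t) (ℕ.n<1+n (suc t))

-- ℓ is carried separately from len ∘ Γ so that the conclusion can speak of the
-- lengths of the cycles of S_(n-1) before extension.
module Deletion
  {N : ℕ} (α A : Permutation′ N) (m u c : Fin N)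
  (α-c : α ⟨$⟩ʳ c ≡ m) (A-m : A ⟨$⟩ʳ m ≡ m)
  (A≡α-elsewhere : ∀ y → y ≢ m → y ≢ u → y ≢ c → A ⟨$⟩ʳ y ≡ α ⟨$⟩ʳ y)
  (A-c : c ≢ m → c ≢ u → A ⟨$⟩ʳ c ≡ α ⟨$⟩ʳ u)
  (A-u : u ≢ m → c ≢ m → A ⟨$⟩ʳ u ≡ α ⟨$⟩ʳ m)
  (A-u-when-c≡m : u ≢ m → c ≡ m → A ⟨$⟩ʳ u ≡ α ⟨$⟩ʳ u)
  {r : ℕ} (Γ : Fin r → Fin N → Fin N) (ℓ : Fin r → ℕ) (ℓ≡len : ∀ i → ℓ i ≡ len (Γ i))
  (Γ-odd : ∀ i → OddCycleFactor A (Γ i))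
  (Γ-injective : ∀ i j → (∀ y → Γ i y ≡ Γ j y) → i ≡ j)
  (ω π : Fin N → Fin N) (ω-cycle : IsCycleOf α m ω) (π-cycle : IsCycleOf α u π)
  (h h′ : ℕ) (h≡len : h ≡ len (α ⟨$⟩ʳ_)) (h′≡len : h′ ≡ len (A ⟨$⟩ʳ_))
  where

  private
    module Oα = Orbits α
    module OA = Orbits A

    αᶠ Aᶠ : Fin N → Fin N
    αᶠ = α ⟨$⟩ʳ_
    Aᶠ = A ⟨$⟩ʳ_

  -- Same, DropOne, DropTwo and DropThree are items (1)–(4) of the theorem for the
  -- rearrangement p of the cycles Γ; Outcome pairs one of them with the matching drop of hd.
  AllPreserved InitPreserved : Permutation′ r → Set
  AllPreserved p  = ∀ i → OddCycleFactor α (Γ (p ⟨$⟩ʳ i))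
  InitPreserved p = ∀ i → suc (toℕ i) < r → OddCycleFactor α (Γ (p ⟨$⟩ʳ i))

  Same DropOne DropTwo DropThree : Permutation′ r → Set
  Same p = AllPreserved p
         ⊎ (0 < r × InitPreserved p × OddCycleFactor α (π ∘ ω)
            × (∀ i → suc (toℕ i) ≡ r → len (π ∘ ω) ≡ ℓ (p ⟨$⟩ʳ i)))
  DropOne p = 1 < r →
      (∀ i → toℕ i + 2 < r → OddCycleFactor α (Γ (p ⟨$⟩ʳ i)))
    × (∀ i → toℕ i + 2 ≡ r → ∀ j → toℕ j + 1 ≡ r →
         ∃[ δ ] (((∀ x → δ x ≡ Γ (p ⟨$⟩ʳ i) x) ⊎ (∀ x → δ x ≡ ω x))
                 × OddCycleFactor α δ
                 × (len δ ≡ ℓ (p ⟨$⟩ʳ i) ⊎ len δ ≡ ℓ (p ⟨$⟩ʳ i) + ℓ (p ⟨$⟩ʳ j) + 1)))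
  DropTwo p = AllPreserved p
            ⊎ (0 < r × InitPreserved p × OddCycleFactor α ω
               × (∀ i → suc (toℕ i) ≡ r → len ω ≡ ℓ (p ⟨$⟩ʳ i) + 2))
  DropThree p = AllPreserved p × OddCycleFactor α ω × len ω ≡ 3

  Conclusion : Permutation′ r → Set
  Conclusion p = (h′ ≡ h → Same p) × (h′ + 1 ≡ h → DropOne p)
               × (h′ + 2 ≡ h → DropTwo p) × (h′ + 3 ≡ h → DropThree p)

  data Outcome (p : Permutation′ r) : Set where
    drop₀ : h ≡ h′ + 0 → Same p → Outcome p
    drop₁ : h ≡ h′ + 1 → DropOne p → Outcome p
    drop₂ : h ≡ h′ + 2 → DropTwo p → Outcome p
    drop₃ : h ≡ h′ + 3 → DropThree p → Outcome p

  private
    absurd-gap : ∀ {d e} {B : Set} → h ≡ h′ + d → h′ + e ≡ h → d ≢ e → B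
    absurd-gap {d} {e} g g′ = contradiction (ℕ.+-cancelˡ-≡ h′ d e (trans (sym g) (sym g′)))

    absurd-gap₀ : ∀ {d} {B : Set} → h ≡ h′ + d → h′ ≡ h → d ≢ 0 → B
    absurd-gap₀ g g′ = absurd-gap g (trans (ℕ.+-identityʳ h′) g′)

  outcome⇒conclusion : ∀ {p} → Outcome p → Conclusion p
  outcome⇒conclusion (drop₀ g s) =
    (λ _ → s) , (λ g′ → absurd-gap g g′ λ ()) , (λ g′ → absurd-gap g g′ λ ()) , (λ g′ → absurd-gap g g′ λ ())
  outcome⇒conclusion (drop₁ g d) =
    (λ g′ → absurd-gap₀ g g′ λ ()) , (λ _ → d) , (λ g′ → absurd-gap g g′ λ ()) , (λ g′ → absurd-gap g g′ λ ())
  outcome⇒conclusion (drop₂ g d) =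
    (λ g′ → absurd-gap₀ g g′ λ ()) , (λ g′ → absurd-gap g g′ λ ()) , (λ _ → d) , (λ g′ → absurd-gap g g′ λ ())
  outcome⇒conclusion (drop₃ g d) =
    (λ g′ → absurd-gap₀ g g′ λ ()) , (λ g′ → absurd-gap g g′ λ ()) , (λ g′ → absurd-gap g g′ λ ()) , (λ _ → d)

  gap : ∀ {a} d → len αᶠ + a ≡ len Aᶠ + (a + d) → h ≡ h′ + d
  gap {a} d e = ℕ.+-cancelʳ-≡ a h (h′ + d) (begin
    h + a               ≡⟨ cong (_+ a) h≡len ⟩
    len αᶠ + a          ≡⟨ e ⟩
    len Aᶠ + (a + d)    ≡⟨ cong (len Aᶠ +_) (ℕ.+-comm a d) ⟩
    len Aᶠ + (d + a)    ≡⟨ ℕ.+-assoc (len Aᶠ) d a ⟨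
    len Aᶠ + d + a      ≡⟨ cong (λ x → x + d + a) h′≡len ⟨
    h′ + d + a          ∎)

  α-m≢m : c ≢ m → α ⟨$⟩ʳ m ≢ m
  α-m≢m c≢m αm≡m = c≢m (sym (⟨$⟩ʳ-injective α (trans αm≡m (sym α-c))))

  α-c≢c : c ≢ m → α ⟨$⟩ʳ c ≢ c
  α-c≢c c≢m αc≡c = c≢m (trans (sym αc≡c) α-c)

  ω-odd : Odd (len ω) → OddCycleFactor α ω
  ω-odd odd = (m , ω-cycle) , odd

  len-ω : α ⟨$⟩ʳ m ≢ m → len ω ≡ Oα.orbit-size m
  len-ω αm≢m = Oα.cycle-len ω-cycle (λ ωm≡m → αm≢m (trans (sym (proj₁ (ω-cycle m) (Oα.orbit-refl m))) ωm≡m))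

  Γ-cycle : ∀ i → IsCycleOf A (proj₁ (proj₁ (Γ-odd i))) (Γ i)
  Γ-cycle i = proj₂ (proj₁ (Γ-odd i))

  ℓ-odd : ∀ i → Odd (ℓ i)
  ℓ-odd i = subst Odd (sym (ℓ≡len i)) (proj₂ (Γ-odd i))

  Γ-fixes : ∀ i {s} → A ⟨$⟩ʳ s ≡ s → Γ i s ≡ s
  Γ-fixes i = OA.cycle-fixes (Γ-cycle i)

  ℓ≡orbit-size : ∀ {j s} → Γ j s ≢ s → ℓ j ≡ OA.orbit-size s
  ℓ≡orbit-size {j} Γjs≢s = trans (ℓ≡len j) (OA.cycle-len (Γ-cycle j) Γjs≢s)

  -- Γ i also avoids m, and off {m, u, c} the permutations A and α agree.
  preserved : ∀ i → Γ i u ≡ u → Γ i c ≡ c → OddCycleFactor α (Γ i)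
  preserved i Γiu≡u Γic≡c = (x , cycle-transfer {α = α} {A} (Γ-cycle i) agree) , proj₂ (Γ-odd i)
    where
    x = proj₁ (proj₁ (Γ-odd i))
    agree : ∀ y → InOrbit A x y → α ⟨$⟩ʳ y ≡ A ⟨$⟩ʳ y
    agree y x⇝y = sym (A≡α-elsewhere y y≢m y≢u y≢c)
      where
      moves = OA.odd-cycle-moves (Γ-cycle i) (proj₂ (Γ-odd i)) x⇝y
      y≢m : y ≢ m
      y≢m refl = moves (Γ-fixes i A-m)
      y≢u : y ≢ u
      y≢u refl = moves Γiu≡u
      y≢c : y ≢ c
      y≢c refl = moves Γic≡c

  mover? : ∀ s → Dec (∃[ j ] Γ j s ≢ s)
  mover? s = Fin.any? (λ j → ¬? (Γ j s ≟ s))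

  only-mover : ∀ {s j} → Γ j s ≢ s → ∀ i → i ≢ j → Γ i s ≡ s
  only-mover {s} {j} Γjs≢s i i≢j with Γ i s ≟ s
  ... | yes Γis≡s = Γis≡s
  ... | no Γis≢s  = contradiction (Γ-injective i j (OA.cycle-unique (Γ-cycle i) (Γ-cycle j) Γis≢s Γjs≢s)) i≢j

  no-mover : ∀ {s} → ¬ (∃[ j ] Γ j s ≢ s) → ∀ i → Γ i s ≡ s
  no-mover {s} none i with Γ i s ≟ s
  ... | yes Γis≡s = Γis≡s
  ... | no Γis≢s  = contradiction (i , Γis≢s) none

  fix-all-but-last : ∀ s → ∃[ p ] (∀ i → suc (toℕ i) < r → Γ (p ⟨$⟩ʳ i) s ≡ s)
  fix-all-but-last s with mover? s
  ... | yes (j , Γjs≢s) = PutLast.p j , λ i lt → only-mover Γjs≢s _ (PutLast.p-init j i lt)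
  ... | no none         = Perm.id , λ i _ → no-mover none i

  drop-one : ∀ {p} → InitPreserved p → DropOne p
  drop-one {p} init _ =
    (λ i lt → init i (ℕ.<-trans (suc<+2 (toℕ i)) lt)) ,
    (λ i e _ _ → Γ (p ⟨$⟩ʳ i) , inj₁ (λ _ → refl) , init i (subst (suc (toℕ i) <_) e (suc<+2 (toℕ i)))
               , inj₁ (sym (ℓ≡len _)))

  module CaseI (c≡m : c ≡ m) where

    A≗α : ∀ y → A ⟨$⟩ʳ y ≡ α ⟨$⟩ʳ y
    A≗α y with y ≟ m | y ≟ u
    ... | yes refl | _        = trans A-m (sym (trans (cong αᶠ (sym c≡m)) α-c))
    ... | no y≢m   | yes refl = A-u-when-c≡m y≢m c≡m
    ... | no y≢m   | no y≢u   = A≡α-elsewhere y y≢m y≢u (λ y≡c → y≢m (trans y≡c c≡m))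

    outcome : ∃[ p ] Outcome p
    outcome = Perm.id , drop₀ (gap {a = 0} 0 (cong (_+ 0) (len-cong {f = αᶠ} {Aᶠ} (sym ∘ A≗α)))) (inj₁ all-preserved)
      where
      all-preserved : AllPreserved Perm.id
      all-preserved i = (_ , cycle-transfer {α = α} {A} (Γ-cycle i) (λ y _ → sym (A≗α y))) , proj₂ (Γ-odd i)

  module CaseII (c≢m : c ≢ m) (u∈mc : u ≡ m ⊎ u ≡ c) where

    A-c′ : A ⟨$⟩ʳ c ≡ α ⟨$⟩ʳ m
    A-c′ = at-c u∈mc
      where
      at-c : u ≡ m ⊎ u ≡ c → A ⟨$⟩ʳ c ≡ α ⟨$⟩ʳ m
      at-c (inj₁ refl) = A-c c≢m c≢m
      at-c (inj₂ refl) = A-u c≢m c≢m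

    agree : ∀ y → y ∉ m ∷ c ∷ [] → α ⟨$⟩ʳ y ≡ A ⟨$⟩ʳ y
    agree y y∉ = sym (A≡α-elsewhere y (y∉ ∘ here) (y≢u u∈mc) (y∉ ∘ there ∘ here))
      where
      y≢u : u ≡ m ⊎ u ≡ c → y ≢ u
      y≢u (inj₁ u≡m) y≡u = y∉ (here (trans y≡u u≡m))
      y≢u (inj₂ u≡c) y≡u = y∉ (there (here (trans y≡u u≡c)))

    preserved′ : ∀ i → Γ i c ≡ c → OddCycleFactor α (Γ i)
    preserved′ i Γic≡c = preserved i (Γ-fixes-u u∈mc) Γic≡c
      where
      Γ-fixes-u : u ≡ m ⊎ u ≡ c → Γ i u ≡ u
      Γ-fixes-u (inj₁ refl) = Γ-fixes i A-m
      Γ-fixes-u (inj₂ refl) = Γic≡c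

    counts : len αᶠ + moved Aᶠ c ≡ len Aᶠ + 2
    counts = begin
      len αᶠ + moved Aᶠ c                          ≡⟨ cong (len αᶠ +_) (ℕ.+-identityʳ _) ⟨
      len αᶠ + (0 + (moved Aᶠ c + 0))              ≡⟨ cong (λ k → len αᶠ + (k + (moved Aᶠ c + 0))) (moved-≡ {f = Aᶠ} A-m) ⟨
      len αᶠ + (moved Aᶠ m + (moved Aᶠ c + 0))     ≡⟨ len-agree-off (m ∷ c ∷ []) ((c≢m ∘ sym ∷ []) ∷ [] ∷ []) agree ⟩
      len Aᶠ + (moved αᶠ m + (moved αᶠ c + 0))     ≡⟨ cong₂ (λ a b → len Aᶠ + (a + (b + 0)))
                                                         (moved-≢ {f = αᶠ} (α-m≢m c≢m)) (moved-≢ {f = αᶠ} (α-c≢c c≢m)) ⟩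
      len Aᶠ + 2                                   ∎

    drop-by : ∀ {x} d → moved Aᶠ c ≡ x → x + d ≡ 2 → h ≡ h′ + d
    drop-by d refl e = gap d (trans counts (cong (len Aᶠ +_) (sym e)))

    outcome : ∃[ p ] Outcome p
    outcome with α ⟨$⟩ʳ m ≟ c
    ... | yes αm≡c = Perm.id , drop₂ (drop-by 2 (moved-≡ {f = Aᶠ} A-c≡c) refl) (inj₁ λ i → preserved′ i (Γ-fixes i A-c≡c))
      where
      A-c≡c = trans A-c′ αm≡c
    ... | no αm≢c with fix-all-but-last c
    ...   | p , init-fixes = p , drop₁ (drop-by 1 (moved-≢ {f = Aᶠ} (αm≢c ∘ trans (sym A-c′))) refl)
                                       (drop-one {p} λ i lt → preserved′ (p ⟨$⟩ʳ i) (init-fixes i lt))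

  module CaseIII (c≢m : c ≢ m) (u≢m : u ≢ m) (u≢c : u ≢ c) where

    A-c′ : A ⟨$⟩ʳ c ≡ α ⟨$⟩ʳ u
    A-c′ = A-c c≢m (u≢c ∘ sym)

    A-u′ : A ⟨$⟩ʳ u ≡ α ⟨$⟩ʳ m
    A-u′ = A-u u≢m c≢m

    m⇝c : InOrbit α m c
    m⇝c = Oα.orbit-sym (1 , α-c)

    A-avoids-m : ∀ {s y} → s ≢ m → InOrbit A s y → y ≢ m
    A-avoids-m s≢m (j , e) refl = s≢m (OA.reaches-fixed j A-m e)

    agree : ∀ y → y ∉ m ∷ u ∷ c ∷ [] → α ⟨$⟩ʳ y ≡ A ⟨$⟩ʳ y
    agree y y∉ = sym (A≡α-elsewhere y (y∉ ∘ here) (y∉ ∘ there ∘ here) (y∉ ∘ there ∘ there ∘ here))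

    counts : len αᶠ + (moved Aᶠ u + moved Aᶠ c) ≡ len Aᶠ + (1 + moved αᶠ u + 1)
    counts = begin
      len αᶠ + (moved Aᶠ u + moved Aᶠ c)
        ≡⟨ cong (λ k → len αᶠ + (moved Aᶠ u + k)) (ℕ.+-identityʳ _) ⟨
      len αᶠ + (0 + (moved Aᶠ u + (moved Aᶠ c + 0)))
        ≡⟨ cong (λ k → len αᶠ + (k + (moved Aᶠ u + (moved Aᶠ c + 0)))) (moved-≡ {f = Aᶠ} A-m) ⟨
      len αᶠ + (moved Aᶠ m + (moved Aᶠ u + (moved Aᶠ c + 0)))
        ≡⟨ len-agree-off (m ∷ u ∷ c ∷ []) ((u≢m ∘ sym ∷ c≢m ∘ sym ∷ []) ∷ (u≢c ∷ []) ∷ [] ∷ []) agree ⟩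
      len Aᶠ + (moved αᶠ m + (moved αᶠ u + (moved αᶠ c + 0)))
        ≡⟨ cong₂ (λ a b → len Aᶠ + (a + (moved αᶠ u + (b + 0))))
                 (moved-≢ {f = αᶠ} (α-m≢m c≢m)) (moved-≢ {f = αᶠ} (α-c≢c c≢m)) ⟩
      len Aᶠ + (1 + moved αᶠ u + 1)
        ∎

    drop-by : ∀ {x y z} d → moved Aᶠ u ≡ x → moved Aᶠ c ≡ y → moved αᶠ u ≡ z → x + y + d ≡ 1 + z + 1 → h ≡ h′ + d
    drop-by d refl refl refl e = gap d (trans counts (cong (len Aᶠ +_) (sym e)))

    module OnCycle (m⇝u : InOrbit α m u) where

      α-u≢u : α ⟨$⟩ʳ u ≢ u
      α-u≢u αu≡u = u≢m (sym (Oα.reaches-fixed (proj₁ m⇝u) αu≡u (proj₂ m⇝u)))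

      -- The α-path from α(m) to the first visit of u avoids m and c; A follows it
      -- and closes it up by A(u) = α(m), so c is not on the A-cycle of u.
      private
        v : ℕ → Fin N
        v j = iter αᶠ (suc j) m

        first-visit : ∃[ t ] (v t ≡ u × (∀ j → j < t → v j ≢ u))
        first-visit = from m⇝u
          where
          from : InOrbit α m u → ∃[ t ] (v t ≡ u × (∀ j → j < t → v j ≢ u))
          from (zero  , m≡u)  = contradiction (sym m≡u) u≢m
          from (suc t , vt≡u) = least-witness (λ j → v j ≡ u) (λ j → v j ≟ u) t vt≡u

        t : ℕ
        t = proj₁ first-visit

        vt≡u : v t ≡ u
        vt≡u = proj₁ (proj₂ first-visit)

        before-u : ∀ j → j < t → v j ≢ u
        before-u = proj₂ (proj₂ first-visit)

        before-m : ∀ j → j < t → v j ≢ m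
        before-m j j<t vj≡m = before-u w w<t vw≡u
          where
          w = t ∸ suc j
          j+w≡t : suc j + w ≡ t
          j+w≡t = ℕ.m+[n∸m]≡n j<t
          w<t : w < t
          w<t = ℕ.≤-trans (ℕ.+-monoˡ-≤ w (s≤s (z≤n {j}))) (ℕ.≤-reflexive j+w≡t)
          vw≡u : v w ≡ u
          vw≡u = begin
            v w                      ≡⟨ cong (iter αᶠ (suc w)) vj≡m ⟨
            iter αᶠ (suc w) (v j)    ≡⟨ cong αᶠ (Oα.iter-+ w (suc j) m) ⟨
            v (w + suc j)            ≡⟨ cong v (trans (ℕ.+-comm w (suc j)) j+w≡t) ⟩
            v t                      ≡⟨ vt≡u ⟩
            u                        ∎

        before-c : ∀ j → j < t → v j ≢ c
        before-c j j<t vj≡c with ℕ.m≤n⇒m<n∨m≡n j<t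
        ... | inj₁ sj<t = before-m (suc j) sj<t (trans (cong αᶠ vj≡c) α-c)
        ... | inj₂ sj≡t = u≢m (trans (sym vt≡u) (trans (cong v (sym sj≡t)) (trans (cong αᶠ vj≡c) α-c)))

        Visited : Fin N → Set
        Visited z = ∃[ j ] (j ≤ t × v j ≡ z)

        visited-step : ∀ z → Visited z → Visited (A ⟨$⟩ʳ z)
        visited-step z (j , j≤t , refl) with ℕ.m≤n⇒m<n∨m≡n j≤t
        ... | inj₁ j<t  = suc j , j<t , sym (A≡α-elsewhere (v j) (before-m j j<t) (before-u j j<t) (before-c j j<t))
        ... | inj₂ refl = 0 , z≤n , trans (sym A-u′) (cong Aᶠ (sym vt≡u))

      u⇝̸c : ¬ InOrbit A u c
      u⇝̸c u⇝c with OA.orbit-ind Visited (t , ℕ.≤-refl , vt≡u) visited-step u⇝c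
      ... | j , j≤t , vj≡c with ℕ.m≤n⇒m<n∨m≡n j≤t
      ...   | inj₁ j<t  = before-c j j<t vj≡c
      ...   | inj₂ refl = u≢c (trans (sym vt≡u) vj≡c)

      A-step-in-orbit : ∀ z → InOrbit α m z → InOrbit α m (A ⟨$⟩ʳ z)
      A-step-in-orbit z m⇝z with z ≟ m | z ≟ u | z ≟ c
      ... | yes refl | _        | _        = subst (InOrbit α m) (sym A-m) m⇝z
      ... | no _     | yes refl | _        = subst (InOrbit α m) (sym A-u′) (Oα.orbit-step (Oα.orbit-refl m))
      ... | no _     | no _     | yes refl = subst (InOrbit α m) (sym A-c′) (Oα.orbit-step m⇝u)
      ... | no z≢m   | no z≢u   | no z≢c   = subst (InOrbit α m) (sym (A≡α-elsewhere z z≢m z≢u z≢c)) (Oα.orbit-step m⇝z)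

      A-orbit⊆α-orbit : ∀ {s y} → InOrbit α m s → InOrbit A s y → InOrbit α m y
      A-orbit⊆α-orbit m⇝s = OA.orbit-ind (InOrbit α m) m⇝s A-step-in-orbit

      α-orbit-split : ∀ {y} → InOrbit α m y → y ≡ m ⊎ InOrbit A u y ⊎ InOrbit A c y
      α-orbit-split = Oα.orbit-ind (λ z → z ≡ m ⊎ InOrbit A u z ⊎ InOrbit A c z) (inj₁ refl) step
        where
        step : ∀ z → z ≡ m ⊎ InOrbit A u z ⊎ InOrbit A c z →
               α ⟨$⟩ʳ z ≡ m ⊎ InOrbit A u (α ⟨$⟩ʳ z) ⊎ InOrbit A c (α ⟨$⟩ʳ z)
        step z (inj₁ refl) = inj₂ (inj₁ (1 , A-u′))
        step z (inj₂ on-A) with z ≟ c | z ≟ u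
        ... | yes refl | _        = inj₁ α-c
        ... | no _     | yes refl = inj₂ (inj₂ (1 , A-c′))
        ... | no z≢c   | no z≢u   = inj₂ (follow on-A)
          where
          z≢m : z ≢ m
          z≢m = [ A-avoids-m u≢m , A-avoids-m c≢m ] on-A
          A≡α : A ⟨$⟩ʳ z ≡ α ⟨$⟩ʳ z
          A≡α = A≡α-elsewhere z z≢m z≢u z≢c
          follow : InOrbit A u z ⊎ InOrbit A c z → InOrbit A u (α ⟨$⟩ʳ z) ⊎ InOrbit A c (α ⟨$⟩ʳ z)
          follow (inj₁ u⇝z) = inj₁ (subst (InOrbit A u) A≡α (OA.orbit-step u⇝z))
          follow (inj₂ c⇝z) = inj₂ (subst (InOrbit A c) A≡α (OA.orbit-step c⇝z))

      orbit-indicator-split : ∀ y → 𝟙 (Oα.orbit? m y) ≡ 𝟙 (y ≟ m) + 𝟙 (OA.orbit? u y) + 𝟙 (OA.orbit? c y)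
      orbit-indicator-split y with Oα.orbit? m y
      ... | no m⇝̸y = sym (cong₂ _+_ (cong₂ _+_
              (𝟙-no (y ≟ m) (λ { refl → m⇝̸y (Oα.orbit-refl _) }))
              (𝟙-no (OA.orbit? u y) (m⇝̸y ∘ A-orbit⊆α-orbit m⇝u)))
              (𝟙-no (OA.orbit? c y) (m⇝̸y ∘ A-orbit⊆α-orbit m⇝c)))
      ... | yes m⇝y with α-orbit-split m⇝y
      ...   | inj₁ refl = sym (cong₂ _+_ (cong₂ _+_
              (𝟙-yes (y ≟ y) refl)
              (𝟙-no (OA.orbit? u y) (λ u⇝m → A-avoids-m u≢m u⇝m refl)))
              (𝟙-no (OA.orbit? c y) (λ c⇝m → A-avoids-m c≢m c⇝m refl)))
      ...   | inj₂ (inj₁ u⇝y) = sym (cong₂ _+_ (cong₂ _+_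
              (𝟙-no (y ≟ m) (A-avoids-m u≢m u⇝y))
              (𝟙-yes (OA.orbit? u y) u⇝y))
              (𝟙-no (OA.orbit? c y) (λ c⇝y → u⇝̸c (OA.orbit-trans u⇝y (OA.orbit-sym c⇝y)))))
      ...   | inj₂ (inj₂ c⇝y) = sym (cong₂ _+_ (cong₂ _+_
              (𝟙-no (y ≟ m) (A-avoids-m c≢m c⇝y))
              (𝟙-no (OA.orbit? u y) (λ u⇝y → u⇝̸c (OA.orbit-trans u⇝y (OA.orbit-sym c⇝y)))))
              (𝟙-yes (OA.orbit? c y) c⇝y))

      len-ω≡ : len ω ≡ 1 + OA.orbit-size u + OA.orbit-size c
      len-ω≡ = begin
        len ω
          ≡⟨ len-ω (α-m≢m c≢m) ⟩
        Oα.orbit-size m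
          ≡⟨ sum-cong-≗ {x = λ y → 𝟙 (Oα.orbit? m y)} {y = λ y → 𝟙 (y ≟ m) + 𝟙 (OA.orbit? u y) + 𝟙 (OA.orbit? c y)}
                        orbit-indicator-split ⟩
        sum (λ y → 𝟙 (y ≟ m) + 𝟙 (OA.orbit? u y) + 𝟙 (OA.orbit? c y))
          ≡⟨ ∑-distrib-+ (λ y → 𝟙 (y ≟ m) + 𝟙 (OA.orbit? u y)) (λ y → 𝟙 (OA.orbit? c y)) ⟩
        sum (λ y → 𝟙 (y ≟ m) + 𝟙 (OA.orbit? u y)) + OA.orbit-size c
          ≡⟨ cong (_+ OA.orbit-size c) (∑-distrib-+ (λ y → 𝟙 (y ≟ m)) (λ y → 𝟙 (OA.orbit? u y))) ⟩
        sum (λ y → 𝟙 (y ≟ m)) + OA.orbit-size u + OA.orbit-size c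
          ≡⟨ cong (λ k → k + OA.orbit-size u + OA.orbit-size c) (sum-𝟙≟ m) ⟩
        1 + OA.orbit-size u + OA.orbit-size c
          ∎

      absorb : ∀ {s t} → (∀ i → Γ i s ≡ s → Γ i t ≡ t → OddCycleFactor α (Γ i)) →
               A ⟨$⟩ʳ t ≡ t → len ω ≡ OA.orbit-size s + 2 → ∃[ p ] DropTwo p
      absorb {s} keep A-t≡t len-ω≡s+2 with mover? s
      ... | no none = Perm.id , inj₁ (λ i → keep i (no-mover none i) (Γ-fixes i A-t≡t))
      ... | yes (j , Γjs≢s) = p , inj₂ (ℕ.≤-<-trans z≤n (Fin.toℕ<n j) , init , ω-odd odd , at-last)
        where
        open PutLast j
        ℓj≡ : ℓ j ≡ OA.orbit-size s
        ℓj≡ = ℓ≡orbit-size Γjs≢s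
        init : InitPreserved p
        init i lt = keep _ (only-mover Γjs≢s _ (p-init i lt)) (Γ-fixes _ A-t≡t)
        odd : Odd (len ω)
        odd = subst Odd (sym len-ω≡s+2) (odd+2 (subst Odd ℓj≡ (ℓ-odd j)))
        at-last : ∀ i → suc (toℕ i) ≡ r → len ω ≡ ℓ (p ⟨$⟩ʳ i) + 2
        at-last i e = trans len-ω≡s+2 (cong (_+ 2) (trans (sym ℓj≡) (cong ℓ (sym (p-last i e)))))

      merge : ∃[ p ] DropOne p
      merge with mover? u | mover? c
      ... | yes (ju , Γu) | yes (jc , Γc) =
        p , λ _ → init , λ i e j e′ → ω , inj₂ (λ _ → refl) , ω-odd odd , inj₂ (len-at i e j e′)
        where
        ju≢jc : ju ≢ jc
        ju≢jc refl = u⇝̸c (OA.orbit-trans (OA.orbit-sym (OA.cycle-support (Γ-cycle ju) Γu)) (OA.cycle-support (Γ-cycle ju) Γc))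
        open PutLastTwo ju jc ju≢jc
        init : ∀ i → toℕ i + 2 < r → OddCycleFactor α (Γ (p ⟨$⟩ʳ i))
        init i lt = preserved _ (only-mover Γu _ (p-init-≢a i lt)) (only-mover Γc _ (p-init-≢b i lt))
        len-ω≡ℓ : len ω ≡ 1 + ℓ ju + ℓ jc
        len-ω≡ℓ = trans len-ω≡ (cong₂ (λ a b → 1 + a + b) (sym (ℓ≡orbit-size Γu)) (sym (ℓ≡orbit-size Γc)))
        odd : Odd (len ω)
        odd = subst Odd (sym len-ω≡ℓ) (odd-merge (ℓ-odd ju) (ℓ-odd jc))
        len-at : ∀ i → toℕ i + 2 ≡ r → ∀ j → toℕ j + 1 ≡ r → len ω ≡ ℓ (p ⟨$⟩ʳ i) + ℓ (p ⟨$⟩ʳ j) + 1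
        len-at i e j e′ = trans len-ω≡ℓ (trans (ℕ.+-comm 1 (ℓ ju + ℓ jc))
                            (cong₂ (λ a b → ℓ a + ℓ b + 1) (sym (p-penultimate i e)) (sym (p-last j e′))))
      ... | yes _ | no none-c with fix-all-but-last u
      ...   | p , init-fixes = p , drop-one {p} λ i lt → preserved _ (init-fixes i lt) (no-mover none-c _)
      merge | no none-u | _ with fix-all-but-last c
      ...   | p , init-fixes = p , drop-one {p} λ i lt → preserved _ (no-mover none-u _) (init-fixes i lt)

      outcome : ∃[ p ] Outcome p
      outcome with α ⟨$⟩ʳ m ≟ u | α ⟨$⟩ʳ u ≟ c
      ... | yes αm≡u | yes αu≡c =
        Perm.id , drop₃ (drop-by 3 (moved-≡ {f = Aᶠ} A-u≡u) (moved-≡ {f = Aᶠ} A-c≡c) (moved-≢ {f = αᶠ} α-u≢u) refl)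
                        ((λ i → preserved i (Γ-fixes i A-u≡u) (Γ-fixes i A-c≡c)) , ω-odd (subst Odd (sym len-ω≡3) (1 , refl)) , len-ω≡3)
        where
        A-u≡u = trans A-u′ αm≡u
        A-c≡c = trans A-c′ αu≡c
        len-ω≡3 : len ω ≡ 3
        len-ω≡3 = trans len-ω≡ (cong₂ (λ a b → 1 + a + b) (OA.orbit-size-fixed A-u≡u) (OA.orbit-size-fixed A-c≡c))
      ... | yes αm≡u | no αu≢c =
        map₂ (drop₂ (drop-by 2 (moved-≡ {f = Aᶠ} A-u≡u) (moved-≢ {f = Aᶠ} (αu≢c ∘ trans (sym A-c′))) (moved-≢ {f = αᶠ} α-u≢u) refl))
             (absorb (λ i Γic≡c Γiu≡u → preserved i Γiu≡u Γic≡c) A-u≡u len-ω≡c+2)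
        where
        A-u≡u = trans A-u′ αm≡u
        len-ω≡c+2 : len ω ≡ OA.orbit-size c + 2
        len-ω≡c+2 = trans len-ω≡ (trans (cong (λ a → 1 + a + OA.orbit-size c) (OA.orbit-size-fixed A-u≡u))
                                         (ℕ.+-comm 2 (OA.orbit-size c)))
      ... | no αm≢u | yes αu≡c =
        map₂ (drop₂ (drop-by 2 (moved-≢ {f = Aᶠ} (αm≢u ∘ trans (sym A-u′))) (moved-≡ {f = Aᶠ} A-c≡c) (moved-≢ {f = αᶠ} α-u≢u) refl))
             (absorb preserved A-c≡c len-ω≡u+2)
        where
        A-c≡c = trans A-c′ αu≡c
        1+a+1 : ∀ a → 1 + a + 1 ≡ a + 2
        1+a+1 = solve-∀
        len-ω≡u+2 : len ω ≡ OA.orbit-size u + 2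
        len-ω≡u+2 = trans len-ω≡ (trans (cong (1 + OA.orbit-size u +_) (OA.orbit-size-fixed A-c≡c)) (1+a+1 (OA.orbit-size u)))
      ... | no αm≢u | no αu≢c =
        map₂ (drop₁ (drop-by 1 (moved-≢ {f = Aᶠ} (αm≢u ∘ trans (sym A-u′))) (moved-≢ {f = Aᶠ} (αu≢c ∘ trans (sym A-c′)))
                               (moved-≢ {f = αᶠ} α-u≢u) refl))
             merge

    module OffCycle (m⇝̸u : ¬ InOrbit α m u) where

      A-u≢u : A ⟨$⟩ʳ u ≢ u
      A-u≢u A-u≡u = m⇝̸u (subst (InOrbit α m) (trans (sym A-u′) A-u≡u) (Oα.orbit-step (Oα.orbit-refl m)))

      -- α(m) = A(u), and from there on α and A agree until α returns to m.
      α-orbit⊆ : ∀ {y} → InOrbit α m y → y ≡ m ⊎ InOrbit A u y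
      α-orbit⊆ m⇝y = proj₂ (Oα.orbit-ind (λ z → InOrbit α m z × (z ≡ m ⊎ InOrbit A u z))
                                          (Oα.orbit-refl m , inj₁ refl) step m⇝y)
        where
        step : ∀ z → InOrbit α m z × (z ≡ m ⊎ InOrbit A u z) →
               InOrbit α m (α ⟨$⟩ʳ z) × (α ⟨$⟩ʳ z ≡ m ⊎ InOrbit A u (α ⟨$⟩ʳ z))
        step z (m⇝z , inj₁ refl) = Oα.orbit-step m⇝z , inj₂ (1 , A-u′)
        step z (m⇝z , inj₂ u⇝z) with z ≟ c | z ≟ u
        ... | yes refl | _        = Oα.orbit-step m⇝z , inj₁ α-c
        ... | no _     | yes refl = contradiction m⇝z m⇝̸u
        ... | no z≢c   | no z≢u   = Oα.orbit-step m⇝z ,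
          inj₂ (subst (InOrbit A u) (A≡α-elsewhere z (A-avoids-m u≢m u⇝z) z≢u z≢c) (OA.orbit-step u⇝z))

      u⇝c : InOrbit A u c
      u⇝c with α-orbit⊆ m⇝c
      ... | inj₁ c≡m = contradiction c≡m c≢m
      ... | inj₂ u⇝c = u⇝c

      preserved′ : ∀ i → Γ i u ≡ u → OddCycleFactor α (Γ i)
      preserved′ i Γiu≡u = preserved i Γiu≡u Γic≡c
        where
        Γic≡c : Γ i c ≡ c
        Γic≡c with Γ i c ≟ c
        ... | yes Γic≡c = Γic≡c
        ... | no Γic≢c  = contradiction (trans (sym (proj₁ (Γ-cycle i u) x⇝u)) Γiu≡u) A-u≢u
          where
          x⇝u = OA.orbit-trans (OA.cycle-support (Γ-cycle i) Γic≢c) (OA.orbit-sym u⇝c)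

      module FixedU (αu≡u : α ⟨$⟩ʳ u ≡ u) where

        π-id : ∀ y → π y ≡ y
        π-id y with Oα.orbit? u y
        ... | yes u⇝y = let y≡u = Oα.orbit-of-fixed αu≡u u⇝y in
                        trans (proj₁ (π-cycle y) u⇝y) (trans (cong αᶠ y≡u) (trans αu≡u (sym y≡u)))
        ... | no u⇝̸y  = proj₂ (π-cycle y) u⇝̸y

        A-orbit⊆ : ∀ {y} → InOrbit A u y → InOrbit α m y ⊎ y ≡ u
        A-orbit⊆ = OA.orbit-ind (λ z → InOrbit α m z ⊎ z ≡ u) (inj₂ refl) step
          where
          step : ∀ z → InOrbit α m z ⊎ z ≡ u → InOrbit α m (A ⟨$⟩ʳ z) ⊎ A ⟨$⟩ʳ z ≡ u
          step z (inj₂ refl) = inj₁ (subst (InOrbit α m) (sym A-u′) (Oα.orbit-step (Oα.orbit-refl m)))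
          step z (inj₁ m⇝z) with z ≟ m | z ≟ c | z ≟ u
          ... | yes refl | _        | _        = inj₁ (subst (InOrbit α m) (sym A-m) m⇝z)
          ... | no _     | yes refl | _        = inj₂ (trans A-c′ αu≡u)
          ... | no _     | no _     | yes refl = contradiction m⇝z m⇝̸u
          ... | no z≢m   | no z≢c   | no z≢u   =
            inj₁ (subst (InOrbit α m) (sym (A≡α-elsewhere z z≢m z≢u z≢c)) (Oα.orbit-step m⇝z))

        -- The α-cycle of m and the A-cycle of u differ only in m versus u.
        indicator-swap : ∀ y → 𝟙 (Oα.orbit? m y) + 𝟙 (y ≟ u) ≡ 𝟙 (OA.orbit? u y) + 𝟙 (y ≟ m)
        indicator-swap y with y ≟ m | y ≟ u
        ... | yes refl | yes m≡u = contradiction (sym m≡u) u≢m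
        ... | yes refl | no _     = trans (cong (_+ 0) (𝟙-yes (Oα.orbit? _ _) (Oα.orbit-refl _)))
                                          (sym (cong (_+ 1) (𝟙-no (OA.orbit? u _) (λ u⇝m → A-avoids-m u≢m u⇝m refl))))
        ... | no _     | yes refl = trans (cong (_+ 1) (𝟙-no (Oα.orbit? m _) m⇝̸u))
                                          (sym (cong (_+ 0) (𝟙-yes (OA.orbit? _ _) (OA.orbit-refl _))))
        ... | no y≢m   | no y≢u   = cong (_+ 0) (𝟙-cong (Oα.orbit? m y) (OA.orbit? u y) to from)
          where
          to : InOrbit α m y → InOrbit A u y
          to m⇝y = [ (λ y≡m → contradiction y≡m y≢m) , id ] (α-orbit⊆ m⇝y)
          from : InOrbit A u y → InOrbit α m y
          from u⇝y = [ id , (λ y≡u → contradiction y≡u y≢u) ] (A-orbit⊆ u⇝y)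

        orbit-size-m≡u : Oα.orbit-size m ≡ OA.orbit-size u
        orbit-size-m≡u = ℕ.+-cancelʳ-≡ 1 _ _ (begin
          Oα.orbit-size m + 1
            ≡⟨ cong (Oα.orbit-size m +_) (sum-𝟙≟ u) ⟨
          Oα.orbit-size m + sum (λ y → 𝟙 (y ≟ u))
            ≡⟨ ∑-distrib-+ (λ y → 𝟙 (Oα.orbit? m y)) (λ y → 𝟙 (y ≟ u)) ⟨
          sum (λ y → 𝟙 (Oα.orbit? m y) + 𝟙 (y ≟ u))
            ≡⟨ sum-cong-≗ {x = λ y → 𝟙 (Oα.orbit? m y) + 𝟙 (y ≟ u)} {y = λ y → 𝟙 (OA.orbit? u y) + 𝟙 (y ≟ m)} indicator-swap ⟩
          sum (λ y → 𝟙 (OA.orbit? u y) + 𝟙 (y ≟ m))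
            ≡⟨ ∑-distrib-+ (λ y → 𝟙 (OA.orbit? u y)) (λ y → 𝟙 (y ≟ m)) ⟩
          OA.orbit-size u + sum (λ y → 𝟙 (y ≟ m))
            ≡⟨ cong (OA.orbit-size u +_) (sum-𝟙≟ m) ⟩
          OA.orbit-size u + 1
            ∎)

        same : ∃[ p ] Same p
        same with mover? u
        ... | no none = Perm.id , inj₁ (λ i → preserved′ i (no-mover none i))
        ... | yes (j , Γju≢u) = p , inj₂ (ℕ.≤-<-trans z≤n (Fin.toℕ<n j) , init , πω-odd , at-last)
          where
          open PutLast j
          len-πω : len (π ∘ ω) ≡ ℓ j
          len-πω = begin
            len (π ∘ ω)        ≡⟨ len-cong {f = π ∘ ω} {ω} (π-id ∘ ω) ⟩
            len ω              ≡⟨ len-ω (α-m≢m c≢m) ⟩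
            Oα.orbit-size m    ≡⟨ orbit-size-m≡u ⟩
            OA.orbit-size u    ≡⟨ ℓ≡orbit-size Γju≢u ⟨
            ℓ j                ∎
          init : InitPreserved p
          init i lt = preserved′ _ (only-mover Γju≢u _ (p-init i lt))
          πω-odd : OddCycleFactor α (π ∘ ω)
          πω-odd = (m , cycle-cong {β = α} ω-cycle (λ y → sym (π-id (ω y)))) , subst Odd (sym len-πω) (ℓ-odd j)
          at-last : ∀ i → suc (toℕ i) ≡ r → len (π ∘ ω) ≡ ℓ (p ⟨$⟩ʳ i)
          at-last i e = trans len-πω (cong ℓ (sym (p-last i e)))

      outcome : ∃[ p ] Outcome p
      outcome with α ⟨$⟩ʳ u ≟ u
      ... | yes αu≡u =
        map₂ (drop₀ (drop-by 0 (moved-≢ {f = Aᶠ} A-u≢u) (moved-≢ {f = Aᶠ} A-c≢c) (moved-≡ {f = αᶠ} αu≡u) refl))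
             (FixedU.same αu≡u)
        where
        A-c≢c : A ⟨$⟩ʳ c ≢ c
        A-c≢c A-c≡c = u≢c (trans (sym (trans A-c′ αu≡u)) A-c≡c)
      ... | no αu≢u with fix-all-but-last u
      ...   | p , init-fixes =
        p , drop₁ (drop-by 1 (moved-≢ {f = Aᶠ} A-u≢u) (moved-≢ {f = Aᶠ} A-c≢c) (moved-≢ {f = αᶠ} αu≢u) refl)
                  (drop-one {p} λ i lt → preserved′ (p ⟨$⟩ʳ i) (init-fixes i lt))
        where
        A-c≢c : A ⟨$⟩ʳ c ≢ c
        A-c≢c A-c≡c = m⇝̸u (Oα.orbit-trans m⇝c (Oα.orbit-sym (1 , trans (sym A-c′) A-c≡c)))

  outcome : ∃[ p ] Outcome p
  outcome with c ≟ m
  ... | yes c≡m = CaseI.outcome c≡m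
  ... | no c≢m with u ≟ m | u ≟ c
  ...   | yes u≡m | _       = CaseII.outcome c≢m (inj₁ u≡m)
  ...   | no _    | yes u≡c = CaseII.outcome c≢m (inj₂ u≡c)
  ...   | no u≢m  | no u≢c with Oα.orbit? m u
  ...     | yes m⇝u = CaseIII.OnCycle.outcome c≢m u≢m u≢c m⇝u
  ...     | no m⇝̸u  = CaseIII.OffCycle.outcome c≢m u≢m u≢c m⇝̸u

  conclusion : ∃[ p ] Conclusion p
  conclusion = map₂ outcome⇒conclusion outcome

lemma5p1 :
  ∀ (k : ℕ) (σ τ : Permutation′ (suc k))
    (r : ℕ) (γ : Fin r → Fin k → Fin k)
  → (∀ i → OddCycleFactor (flip (contraction σ) ∘ₚ contraction τ) (γ i))
  → (∀ i j → (∀ x → γ i x ≡ γ j x) → i ≡ j)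
  → (ω π : Fin (suc k) → Fin (suc k))
  → IsCycleOf (flip σ ∘ₚ τ) (fromℕ k) ω
  → IsCycleOf (flip σ ∘ₚ τ) (σ ⟨$⟩ʳ fromℕ k) π
  → ∃[ p ]
    (let γ′ : Fin r → Fin k → Fin k
         γ′ i = γ (p ⟨$⟩ʳ i)
         α = flip σ ∘ₚ τ
         h = hd (σ ⟨$⟩ʳ_) (τ ⟨$⟩ʳ_)
         h′ = hd (contraction σ ⟨$⟩ʳ_) (contraction τ ⟨$⟩ʳ_)
     in (h′ ≡ h →
           (∀ i → OddCycleFactor α (ext (γ′ i)))
           ⊎ (0 < r
              × (∀ i → suc (toℕ i) < r → OddCycleFactor α (ext (γ′ i)))
              × OddCycleFactor α (π ∘ ω)
              × (∀ i → suc (toℕ i) ≡ r → len (π ∘ ω) ≡ len (γ′ i))))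
      × (h′ + 1 ≡ h → 1 < r →
           (∀ i → toℕ i + 2 < r → OddCycleFactor α (ext (γ′ i)))
           × (∀ i → toℕ i + 2 ≡ r → ∀ j → toℕ j + 1 ≡ r →
                ∃[ δ ] (((∀ x → δ x ≡ ext (γ′ i) x) ⊎ (∀ x → δ x ≡ ω x))
                        × OddCycleFactor α δ
                        × (len δ ≡ len (γ′ i) ⊎ len δ ≡ len (γ′ i) + len (γ′ j) + 1))))
      × (h′ + 2 ≡ h →
           (∀ i → OddCycleFactor α (ext (γ′ i)))
           ⊎ (0 < r
              × (∀ i → suc (toℕ i) < r → OddCycleFactor α (ext (γ′ i)))
              × OddCycleFactor α ω
              × (∀ i → suc (toℕ i) ≡ r → len ω ≡ len (γ′ i) + 2)))
      × (h′ + 3 ≡ h →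
           (∀ i → OddCycleFactor α (ext (γ′ i)))
           × OddCycleFactor α ω
           × len ω ≡ 3))
lemma5p1 k σ τ r γ γ-odd γ-injective ω π ω-cycle π-cycle =
  Deletion.conclusion α A m u c α-c A-m A≡α-elsewhere A-c A-u A-u-when-c≡m
    (ext ∘ γ) (len ∘ γ) (λ i → sym (len-ext (γ i))) extended-odd
    (λ i j e → γ-injective i j (ext-injective (γ i) (γ j) e))
    ω π ω-cycle π-cycle
    (hd (σ ⟨$⟩ʳ_) (τ ⟨$⟩ʳ_)) (hd (contraction σ ⟨$⟩ʳ_) (contraction τ ⟨$⟩ʳ_))
    (hd≡len[σ⁻¹τ] σ τ) (trans (hd≡len[σ⁻¹τ] (contraction σ) (contraction τ)) (sym (len-ext (αᶜ ⟨$⟩ʳ_))))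
  where
  open ContractionOfQuotient σ τ
  αᶜ = flip (contraction σ) ∘ₚ contraction τ
  extended-odd : ∀ i → OddCycleFactor A (ext (γ i))
  extended-odd i = (_ , cycle-ext {α = αᶜ} (proj₂ (proj₁ (γ-odd i)))) , subst Odd (sym (len-ext (γ i))) (proj₂ (γ-odd i))
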